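{- Let $G$ be a finite cactus graph. Then $G$ is traceable (i.e., contains a Hamiltonian path, a path containing every vertex of $G$ exactly once) if and only if all of the following three conditions hold: (1) every vertex of $G$ has criticality at most two; (2) every biconnected component of $G$ contains at most two articulation vertices of $G$; (3) whenever a biconnected component of $G$ contains two articulation vertices of $G$, these two vertices are joined by an edge of $G$.
   Context: Graphs are finite and simple. For a connected graph $G=(V,E)$ and a vertex $v\in V$, $G-v$ denotes the graph with vertex set $V\setminus\{v\}$ and edge set $\{e\in E : v\notin e\}$. The criticality of $v$ is the number of connected components of $G-v$; $v$ is an articulation vertex if $G-v$ is disconnected. A biconnected component (block) of $G$ is a maximal connected subgraph of $G$ with no articulation vertex of its own (a bridge with its endpoints is a biconnected component). A cactus graph is a connected graph in which every biconnected component is either a single edge or a simple cycle. -}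

module Defs where

open import Data.Nat using (ℕ; zero; suc; _≤_; _≥_)
open import Data.Fin using (Fin; toℕ)
open import Data.Bool using (Bool; true; false; T)
open import Data.Product using (Σ; ∃; ∃-syntax; _×_; _,_)
open import Data.Sum using (_⊎_)
open import Data.Empty using (⊥)
open import Relation.Nullary using (¬_)
open import Relation.Binary.PropositionalEquality using (_≡_; _≢_)
open import Function.Bundles using (_⇔_)
open import Level using (0ℓ)

record Graph : Set where
  field
    n     : ℕ
    adj   : Fin n → Fin n → Bool
    sym   : ∀ u v → adj u v ≡ adj v u
    irrefl : ∀ v → adj v v ≡ false

  Vertex : Set
  Vertex = Fin n

  Adj : Vertex → Vertex → Set
  Adj u v = T (adj u v)

open Graph public

record Subgraph (G : Graph) : Set₁ where
  field
    inV    : Vertex G → Set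
    inE    : Vertex G → Vertex G → Set
    inE-sym : ∀ {u w} → inE u w → inE w u
    inE-adj : ∀ {u w} → inE u w → Adj G u w
    inE-V   : ∀ {u w} → inE u w → inV u × inV w

open Subgraph public

module _ {G : Graph} where

  whole : Subgraph G
  whole = record
    { inV = λ _ → Data.Unit.⊤
    ; inE = λ u w → Adj G u w
    ; inE-sym = λ {u} {w} e → subst T (sym G u w) e
    ; inE-adj = λ e → e
    ; inE-V = λ _ → _ , _
    }
    where
      open import Relation.Binary.PropositionalEquality using (subst)
      import Data.Unit

  _-ᵛ_ : Subgraph G → Vertex G → Subgraph G
  H -ᵛ x = record
    { inV = λ u → inV H u × u ≢ x
    ; inE = λ u w → inE H u w × u ≢ x × w ≢ x
    ; inE-sym = λ { (e , p , q) → inE-sym H e , q , p }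
    ; inE-adj = λ { (e , _ , _) → inE-adj H e }
    ; inE-V = λ { (e , p , q) → let (a , b) = inE-V H e in (a , p) , (b , q) }
    }

  _⊆ᴳ_ : Subgraph G → Subgraph G → Set
  H ⊆ᴳ K = (∀ u → inV H u → inV K u) × (∀ u w → inE H u w → inE K u w)

  data Reach (H : Subgraph G) : Vertex G → Vertex G → Set where
    here : ∀ {u} → inV H u → Reach H u u
    step : ∀ {u x w} → inE H u x → Reach H x w → Reach H u w

  Connected : Subgraph G → Set
  Connected H = (∃[ v ] inV H v) × (∀ u w → inV H u → inV H w → Reach H u w)

  Disconnected : Subgraph G → Set
  Disconnected H = ∃[ u ] ∃[ w ] (inV H u × inV H w × ¬ Reach H u w)

  -- H has exactly k connected components: there are k representatives,
  -- lying in pairwise distinct components, covering every component.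
  NumComponents : Subgraph G → ℕ → Set
  NumComponents H k =
    Σ (Fin k → Vertex G) λ r →
      (∀ i → inV H (r i)) ×
      (∀ i j → Reach H (r i) (r j) → i ≡ j) ×
      (∀ u → inV H u → ∃[ i ] Reach H u (r i))

  CriticalityAtMost2 : Vertex G → Set
  CriticalityAtMost2 v = ∀ k → NumComponents (whole -ᵛ v) k → k ≤ 2

  IsArticulationOf : Subgraph G → Vertex G → Set
  IsArticulationOf H v = inV H v × Disconnected (H -ᵛ v)

  ArticulationVertex : Vertex G → Set
  ArticulationVertex v = IsArticulationOf whole v

  NoArticulation : Subgraph G → Set
  NoArticulation H = ∀ v → ¬ IsArticulationOf H v

  IsBlock : Subgraph G → Set₁
  IsBlock B = Connected B × NoArticulation B ×
    (∀ (H : Subgraph G) → B ⊆ᴳ H → Connected H → NoArticulation H → H ⊆ᴳ B)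

  IsSingleEdge : Subgraph G → Set
  IsSingleEdge B = ∃[ a ] ∃[ b ] (a ≢ b ×
    (∀ u → inV B u ⇔ (u ≡ a ⊎ u ≡ b)) ×
    (∀ u w → inE B u w ⇔ ((u ≡ a × w ≡ b) ⊎ (u ≡ b × w ≡ a))))

  CycSucc : {k : ℕ} → Fin k → Fin k → Set
  CycSucc {k} i j = suc (toℕ i) ≡ toℕ j ⊎ (suc (toℕ i) ≡ k × toℕ j ≡ 0)

  IsSimpleCycle : Subgraph G → Set
  IsSimpleCycle B = ∃[ k ] Σ (Fin k → Vertex G) λ c →
    k ≥ 3 ×
    (∀ i j → c i ≡ c j → i ≡ j) ×
    (∀ u → inV B u ⇔ (∃[ i ] c i ≡ u)) ×
    (∀ u w → inE B u w ⇔
       (∃[ i ] ∃[ j ] (CycSucc i j × ((u ≡ c i × w ≡ c j) ⊎ (u ≡ c j × w ≡ c i)))))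

IsCactus : Graph → Set₁
IsCactus G = Connected (whole {G}) ×
  (∀ (B : Subgraph G) → IsBlock B → IsSingleEdge B ⊎ IsSimpleCycle B)

Traceable : Graph → Set
Traceable G = Σ (Fin (n G) → Vertex G) λ p →
  (∀ i j → p i ≡ p j → i ≡ j) ×
  (∀ v → ∃[ i ] p i ≡ v) ×
  (∀ i j → suc (toℕ i) ≡ toℕ j → Adj G (p i) (p j))

Cond1 : Graph → Set
Cond1 G = ∀ (v : Vertex G) → CriticalityAtMost2 {G} v

Cond2 : Graph → Set₁
Cond2 G = ∀ (B : Subgraph G) → IsBlock B →
  ¬ (∃[ a ] ∃[ b ] ∃[ c ] (a ≢ b × a ≢ c × b ≢ c ×
      inV B a × inV B b × inV B c ×
      ArticulationVertex {G} a × ArticulationVertex {G} b × ArticulationVertex {G} c))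

Cond3 : Graph → Set₁
Cond3 G = ∀ (B : Subgraph G) → IsBlock B → ∀ a b → a ≢ b →
  inV B a → inV B b → ArticulationVertex {G} a → ArticulationVertex {G} b →
  Adj G a b

-- Necessity. Along a Hamiltonian path P, deleting a vertex v leaves the two
-- sides of v on P, each connected, so G - v has at most two components. A
-- block B cannot meet both sides of one of its articulation vertices x on P:
-- B - x is connected while x separates the two sides. Hence B contains at
-- most two articulation vertices a, b; the stretch of P between them together
-- with B has no articulation vertex, so by maximality it lies inside B, and on
-- the cycle B this forces a and b to be adjacent.
--
-- Sufficiency. Take a longest path P and suppose a vertex lies off P. By
-- connectivity some w off P is adjacent to a vertex p of P, which must be
-- interior, splitting P into two arms with first vertices a and b. If w reaches
-- an arm in G - p, the resulting ear either lengthens P or closes a cycle on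
-- which p would get a third neighbour. Otherwise either a and b are separated
-- in G - p, giving three components against (1), or p, a, b lie on one cycle;
-- then (2) and (3) leave p and b as the only articulation vertices on that
-- cycle (after swapping the arms), so the arm through a runs along the cycle,
-- and the cycle neighbour of its end either extends P or rotates it into a
-- longer path.

module Submission where

open import Defs
open import Data.Nat using (ℕ; zero; suc; _≤_; _<_; _≥_; z≤n; s≤s; _+_)
import Data.Nat.Properties as ℕP
import Data.List.Properties as LP
import Data.List.Relation.Unary.Any.Properties as AnyP
open import Data.Fin as F using (Fin; toℕ) renaming (zero to fz; suc to fs)
open import Data.Fin.Properties as FP using (_≟_; any?; all?)
open import Data.Bool using (Bool; true; false; T; _∧_; not)
open import Data.Bool.Properties using (T?)
open import Data.Product
open import Data.Sum
open import Data.Empty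
open import Data.Unit using (⊤; tt)
open import Data.List using (List; []; _∷_; _++_; _ʳ++_; reverse; length)
open import Data.List.Membership.Propositional using (_∈_; _∉_; find; lose)
open import Data.List.Membership.Propositional.Properties
open import Data.List.Relation.Unary.Any as Any using (Any; here; there)
open import Relation.Nullary
open import Relation.Nullary.Decidable using (_×-dec_; _⊎-dec_; ¬?; ⌊_⌋)
open import Relation.Binary.PropositionalEquality renaming (sym to esym)
open import Function.Bundles using (_⇔_; Equivalence; mk⇔)

module _ {G : Graph} {H : Subgraph G} where

  Reach-source : ∀ {u w} → Reach H u w → inV H u
  Reach-source (here p) = p
  Reach-source (step e r) = proj₁ (inE-V H e)

  Reach-target : ∀ {u w} → Reach H u w → inV H w
  Reach-target (here p) = p
  Reach-target (step e r) = Reach-target r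

  Reach-trans : ∀ {u x w} → Reach H u x → Reach H x w → Reach H u w
  Reach-trans (here _) r = r
  Reach-trans (step e r) r' = step e (Reach-trans r r')

  Reach-snoc : ∀ {u x w} → Reach H u x → inE H x w → Reach H u w
  Reach-snoc r e = Reach-trans r (step e (here (proj₂ (inE-V H e))))

  Reach-sym : ∀ {u w} → Reach H u w → Reach H w u
  Reach-sym (here p) = here p
  Reach-sym (step e r) = Reach-snoc (Reach-sym r) (inE-sym H e)

  Reach-mono : ∀ {K : Subgraph G} → H ⊆ᴳ K → ∀ {u w} → Reach H u w → Reach K u w
  Reach-mono (f , g) (here p) = here (f _ p)
  Reach-mono (f , g) (step e r) = step (g _ _ e) (Reach-mono (f , g) r)

module _ {X : Set} where

  Uniq : List X → Set
  Uniq [] = ⊤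
  Uniq (x ∷ xs) = x ∉ xs × Uniq xs

  Disjoint : List X → List X → Set
  Disjoint xs ys = ∀ y → y ∈ xs → y ∉ ys

  lastOf : X → List X → X
  lastOf x [] = x
  lastOf x (y ∷ ys) = lastOf y ys

  Disjoint-sym : ∀ xs ys → Disjoint xs ys → Disjoint ys xs
  Disjoint-sym xs ys d y yy yx = d y yx yy

  ∈∧∉⇒≢ : ∀ {z : X} {xs} → z ∈ xs → ∀ {y} → y ∉ xs → y ≢ z
  ∈∧∉⇒≢ p q refl = q p

  ∈-ʳ++⁺ˡ : ∀ {y} (xs ys : List X) → y ∈ xs → y ∈ xs ʳ++ ys
  ∈-ʳ++⁺ˡ xs ys p = AnyP.reverseAcc⁺ ys xs (inj₂ p)

  ∈-ʳ++⁺ʳ : ∀ {y} (xs ys : List X) → y ∈ ys → y ∈ xs ʳ++ ys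
  ∈-ʳ++⁺ʳ xs ys p = AnyP.reverseAcc⁺ ys xs (inj₁ p)

  ʳ++-++ : ∀ (xs ys zs : List X) → (xs ʳ++ ys) ++ zs ≡ xs ʳ++ (ys ++ zs)
  ʳ++-++ [] ys zs = refl
  ʳ++-++ (x ∷ xs) ys zs = ʳ++-++ xs (x ∷ ys) zs

  lastOf-∈ : ∀ x xs → lastOf x xs ∈ x ∷ xs
  lastOf-∈ x [] = here refl
  lastOf-∈ x (y ∷ ys) = there (lastOf-∈ y ys)

  lastOf-++ : ∀ v xs x ys → lastOf v (xs ++ x ∷ ys) ≡ lastOf x ys
  lastOf-++ v [] x ys = refl
  lastOf-++ v (y ∷ xs) x ys = lastOf-++ y xs x ys

  lastOf-self : ∀ x xs → x ∉ xs → lastOf x xs ≡ x → xs ≡ []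
  lastOf-self x [] _ _ = refl
  lastOf-self x (y ∷ xs) x∉ e = ⊥-elim (x∉ (subst (_∈ y ∷ xs) e (lastOf-∈ y xs)))

  init-last : ∀ x xs → ∃ λ I → x ∷ xs ≡ I ++ lastOf x xs ∷ []
  init-last x [] = [] , refl
  init-last x (y ∷ ys) with init-last y ys
  ... | I , e = x ∷ I , cong (x ∷_) e

  ʳ++-head : ∀ x xs ys → ∃ λ T → (x ∷ xs) ʳ++ ys ≡ lastOf x xs ∷ T
  ʳ++-head x [] ys = ys , refl
  ʳ++-head x (y ∷ xs) ys = ʳ++-head y xs (x ∷ ys)

  ʳ++-last : ∀ (xs : List X) x ys → ∃ λ I → xs ʳ++ (x ∷ ys) ≡ I ++ lastOf x ys ∷ []
  ʳ++-last xs x [] = reverse xs , esym (ʳ++-++ xs [] (x ∷ []))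
  ʳ++-last xs x (y ∷ ys) = ʳ++-last (x ∷ xs) y ys

  Uniq-++ : ∀ (xs ys : List X) → Uniq xs → Uniq ys → Disjoint xs ys → Uniq (xs ++ ys)
  Uniq-++ [] ys ux uy d = uy
  Uniq-++ (a ∷ xs) ys (a∉ , ux) uy d =
    (λ q → [ a∉ , d a (here refl) ]′ (∈-++⁻ xs q)) , Uniq-++ xs ys ux uy (λ y p → d y (there p))

  Uniq-++⁻ : ∀ (xs ys : List X) → Uniq (xs ++ ys) → Uniq xs × Uniq ys × Disjoint xs ys
  Uniq-++⁻ [] ys u = tt , u , (λ _ ())
  Uniq-++⁻ (a ∷ xs) ys (a∉ , u) with Uniq-++⁻ xs ys u
  ... | ux , uy , d = ((λ q → a∉ (∈-++⁺ˡ q)) , ux) , uy ,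
        (λ { y (here refl) q → a∉ (∈-++⁺ʳ xs q) ; y (there p) q → d y p q })

  Uniq-ʳ++ : ∀ (xs ys : List X) → Uniq xs → Uniq ys → Disjoint xs ys → Uniq (xs ʳ++ ys)
  Uniq-ʳ++ [] ys ux uy d = uy
  Uniq-ʳ++ (a ∷ xs) ys (a∉ , ux) uy d =
    Uniq-ʳ++ xs (a ∷ ys) ux (d a (here refl) , uy)
      (λ { y yx (here refl) → a∉ yx ; y yx (there q) → d y (there yx) q })

  Uniq-ʳ++⁻ : ∀ (xs ys : List X) → Uniq (xs ʳ++ ys) → Uniq xs × Uniq ys × Disjoint xs ys
  Uniq-ʳ++⁻ [] ys u = tt , u , (λ _ ())
  Uniq-ʳ++⁻ (a ∷ xs) ys u with Uniq-ʳ++⁻ xs (a ∷ ys) u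
  ... | ux , (a∉ , uy) , d = ((λ q → d a q (here refl)) , ux) , uy ,
        (λ { y (here refl) q → a∉ q ; y (there p) q → d y p (there q) })

  Uniq-reverse : ∀ (xs : List X) → Uniq xs → Uniq (reverse xs)
  Uniq-reverse xs u = Uniq-ʳ++ xs [] u tt (λ _ _ ())

  Uniq-++-middle : ∀ (xs : List X) y ys → Uniq (xs ++ y ∷ ys) → y ∉ xs × y ∉ ys
  Uniq-++-middle xs y ys u with Uniq-++⁻ xs (y ∷ ys) u
  ... | ux , (y∉ , uy) , d = (λ q → d y q (here refl)) , y∉

  Uniq-insert : ∀ (xs ys : List X) {y} → Uniq (xs ++ ys) → y ∉ xs ++ ys → Uniq (xs ++ y ∷ ys)
  Uniq-insert [] ys u y∉ = y∉ , u
  Uniq-insert (a ∷ xs) ys (a∉ , u) y∉ =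
    (λ q → [ (λ r → a∉ (∈-++⁺ˡ r)) , (λ { (here refl) → y∉ (here refl) ; (there r) → a∉ (∈-++⁺ʳ xs r) }) ]′ (∈-++⁻ xs q)) ,
    Uniq-insert xs ys u (λ q → y∉ (there q))

  Consecutive : List X → X → X → Set
  Consecutive [] u w = ⊥
  Consecutive (x ∷ []) u w = ⊥
  Consecutive (x ∷ y ∷ r) u w = (u ≡ x × w ≡ y) ⊎ Consecutive (y ∷ r) u w

  Consecutive-∈ : ∀ (Xs : List X) {u w} → Consecutive Xs u w → u ∈ Xs × w ∈ Xs
  Consecutive-∈ (x ∷ y ∷ r) (inj₁ (refl , refl)) = here refl , there (here refl)
  Consecutive-∈ (x ∷ y ∷ r) (inj₂ z) with Consecutive-∈ (y ∷ r) z
  ... | p , q = there p , there q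

  Consecutive-∷ : ∀ (x : X) Xs {u w} → Consecutive Xs u w → Consecutive (x ∷ Xs) u w
  Consecutive-∷ x (y ∷ r) z = inj₂ z

  Consecutive-++ˡ : ∀ (Ys Xs : List X) {u w} → Consecutive Xs u w → Consecutive (Ys ++ Xs) u w
  Consecutive-++ˡ [] Xs z = z
  Consecutive-++ˡ (y ∷ Ys) Xs z = Consecutive-∷ y (Ys ++ Xs) (Consecutive-++ˡ Ys Xs z)

  Consecutive-++ʳ : ∀ (Xs Ys : List X) {u w} → Consecutive Xs u w → Consecutive (Xs ++ Ys) u w
  Consecutive-++ʳ (x ∷ y ∷ r) Ys (inj₁ e) = inj₁ e
  Consecutive-++ʳ (x ∷ y ∷ r) Ys (inj₂ z) = inj₂ (Consecutive-++ʳ (y ∷ r) Ys z)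

  Consecutive-middle : ∀ (Xs : List X) u w Ys → Consecutive (Xs ++ u ∷ w ∷ Ys) u w
  Consecutive-middle Xs u w Ys = Consecutive-++ˡ Xs (u ∷ w ∷ Ys) (inj₁ (refl , refl))

  Consecutive-last : ∀ x xs y ys → Consecutive (x ∷ xs ++ y ∷ ys) (lastOf x xs) y
  Consecutive-last x [] y ys = inj₁ (refl , refl)
  Consecutive-last x (x' ∷ xs) y ys = inj₂ (Consecutive-last x' xs y ys)

  split-at : ∀ j (Q : List X) → j ≤ length Q → ∃ λ Q1 → ∃ λ Q2 → Q ≡ Q1 ++ Q2 × length Q1 ≡ j
  split-at zero Q _ = [] , Q , refl , refl
  split-at (suc j) (x ∷ Q) (s≤s le) with split-at j Q le
  ... | Q1 , Q2 , refl , refl = x ∷ Q1 , Q2 , refl , refl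

  lookup-injective : ∀ (P : List X) → Uniq P → ∀ i j → Data.List.lookup P i ≡ Data.List.lookup P j → i ≡ j
  lookup-injective (x ∷ P) u fz fz e = refl
  lookup-injective (x ∷ P) u fz (fs j) e = ⊥-elim (proj₁ u (subst (_∈ P) (esym e) (∈-lookup {xs = P} j)))
  lookup-injective (x ∷ P) u (fs i) fz e = ⊥-elim (proj₁ u (subst (_∈ P) e (∈-lookup {xs = P} i)))
  lookup-injective (x ∷ P) u (fs i) (fs j) e = cong fs (lookup-injective P (proj₂ u) i j e)

three-distinct⇒3≤ : ∀ {k} (i j l : Fin k) → i ≢ j → i ≢ l → j ≢ l → 3 ≤ k
three-distinct⇒3≤ {suc (suc (suc k))} _ _ _ _ _ _ = s≤s (s≤s (s≤s z≤n))
three-distinct⇒3≤ {suc zero} fz fz _ a _ _ = ⊥-elim (a refl)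
three-distinct⇒3≤ {suc (suc zero)} fz fz _ a _ _ = ⊥-elim (a refl)
three-distinct⇒3≤ {suc (suc zero)} (fs fz) (fs fz) _ a _ _ = ⊥-elim (a refl)
three-distinct⇒3≤ {suc (suc zero)} fz (fs fz) fz _ b _ = ⊥-elim (b refl)
three-distinct⇒3≤ {suc (suc zero)} fz (fs fz) (fs fz) _ _ c = ⊥-elim (c refl)
three-distinct⇒3≤ {suc (suc zero)} (fs fz) fz fz _ _ c = ⊥-elim (c refl)
three-distinct⇒3≤ {suc (suc zero)} (fs fz) fz (fs fz) _ b _ = ⊥-elim (b refl)

module _ {n : ℕ} where

  Uniq-length≤ : ∀ (P : List (Fin n)) → Uniq P → length P ≤ n
  Uniq-length≤ P u = FP.injective⇒≤ (λ {i} {j} e → lookup-injective P u i j e)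

  exists-list-of-length? : ∀ k (Pr : List (Fin n) → Set) → (∀ xs → Dec (Pr xs)) → Dec (∃ λ xs → length xs ≡ k × Pr xs)
  exists-list-of-length? zero Pr d with d []
  ... | yes p = yes ([] , refl , p)
  ... | no np = no (λ { ([] , _ , p) → np p ; (x ∷ xs , () , _) })
  exists-list-of-length? (suc k) Pr d with any? (λ x → exists-list-of-length? k (λ xs → Pr (x ∷ xs)) (λ xs → d (x ∷ xs)))
  ... | yes (x , xs , e , p) = yes (x ∷ xs , cong suc e , p)
  ... | no nn = no (λ { (x ∷ xs , e , p) → nn (x , xs , ℕP.suc-injective e , p) ; ([] , () , _) })

size : ∀ {k} → (Fin k → Bool) → ℕ
size {zero} m = 0
size {suc k} m with m fz
... | true = suc (size (λ i → m (fs i)))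
... | false = size (λ i → m (fs i))

size-mono : ∀ {k} (m m' : Fin k → Bool) → (∀ x → T (m' x) → T (m x)) → size m' ≤ size m
size-mono {zero} m m' sub = z≤n
size-mono {suc k} m m' sub with m fz | m' fz | sub fz
... | true | true | _ = s≤s (size-mono _ _ (λ x → sub (fs x)))
... | true | false | _ = ℕP.m≤n⇒m≤1+n (size-mono _ _ (λ x → sub (fs x)))
... | false | true | h = ⊥-elim (h tt)
... | false | false | _ = size-mono _ _ (λ x → sub (fs x))

size-mono-< : ∀ {k} (m m' : Fin k → Bool) → (∀ x → T (m' x) → T (m x)) → ∀ u → T (m u) → ¬ T (m' u) → size m' < size m
size-mono-< {suc k} m m' sub fz mu nm' with m fz | m' fz | sub fz
... | true | true | _ = ⊥-elim (nm' tt)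
... | true | false | _ = s≤s (size-mono _ _ (λ x → sub (fs x)))
... | false | _ | _ = ⊥-elim mu
size-mono-< {suc k} m m' sub (fs u) mu nm' with m fz | m' fz | sub fz
... | true | true | _ = s≤s (size-mono-< _ _ (λ x → sub (fs x)) u mu nm')
... | true | false | _ = ℕP.m≤n⇒m≤1+n (size-mono-< _ _ (λ x → sub (fs x)) u mu nm')
... | false | true | h = ⊥-elim (h tt)
... | false | false | _ = size-mono-< _ _ (λ x → sub (fs x)) u mu nm'

module _ (G : Graph) where

  open import Data.List.Membership.DecPropositional (_≟_ {n G}) using (_∈?_)

  V : Set
  V = Vertex G

  A : V → V → Set
  A = Adj G

  Adj? : ∀ u v → Dec (A u v)
  Adj? u v = T? (adj G u v)

  Adj-sym : ∀ {u v} → A u v → A v u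
  Adj-sym {u} {v} e = subst T (Graph.sym G u v) e

  Adj⇒≢ : ∀ {u v} → A u v → u ≢ v
  Adj⇒≢ {v = v} e refl = subst T (irrefl G v) e

  Mask : Set
  Mask = V → Bool

  induced : Mask → Subgraph G
  induced m = record
    { inV = λ u → T (m u)
    ; inE = λ u w → T (m u) × T (m w) × A u w
    ; inE-sym = λ { (a , b , e) → b , a , Adj-sym e }
    ; inE-adj = λ { (a , b , e) → e }
    ; inE-V = λ { (a , b , e) → a , b }
    }

  remove : V → Mask → Mask
  remove u m x = m x ∧ not ⌊ x ≟ u ⌋

  remove⁺ : ∀ u m x → T (m x) → x ≢ u → T (remove u m x)
  remove⁺ u m x p q with m x | x ≟ u
  ... | true | no _ = tt
  ... | true | yes e = q e
  ... | false | _ = p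

  remove⊆ : ∀ u m x → T (remove u m x) → T (m x)
  remove⊆ u m x p with m x
  ... | true = tt
  ... | false = p

  remove-≢ : ∀ u m x → T (remove u m x) → x ≢ u
  remove-≢ u m x p with m x | x ≟ u
  ... | true | no ne = ne
  ... | true | yes _ = ⊥-elim p
  ... | false | _ = ⊥-elim p

  induced-remove⊆ : ∀ u m → induced (remove u m) ⊆ᴳ induced m
  induced-remove⊆ u m = (λ x p → remove⊆ u m x p) , (λ { x y (a , b , e) → remove⊆ u m x a , remove⊆ u m y b , e })

  size-remove : ∀ m u → T (m u) → size (remove u m) < size m
  size-remove m u mu = size-mono-< m (remove u m) (remove⊆ u m) u mu (λ p → remove-≢ u m u p refl)

  Reach-last-exit⊎ : ∀ m u {a v} → Reach (induced m) a v → u ≢ v →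
    Reach (induced (remove u m)) a v ⊎ (∃ λ y → A u y × Reach (induced (remove u m)) y v)
  Reach-last-exit⊎ m u (here {a} ma) u≢v = inj₁ (here (remove⁺ u m a ma (λ e → u≢v (esym e))))
  Reach-last-exit⊎ m u (step {a} {x} (ma , mx , e) r) u≢v with Reach-last-exit⊎ m u r u≢v
  ... | inj₂ q = inj₂ q
  ... | inj₁ r' with a ≟ u
  ...   | yes refl = inj₂ (x , e , r')
  ...   | no a≢u = inj₁ (step (remove⁺ u m a ma a≢u , Reach-source r' , e) r')

  Reach-last-exit : ∀ m u {v} → Reach (induced m) u v → u ≢ v →
    ∃ λ y → A u y × Reach (induced (remove u m)) y v
  Reach-last-exit m u r ne with Reach-last-exit⊎ m u r ne
  ... | inj₂ q = q
  ... | inj₁ r' = ⊥-elim (remove-≢ u m u (Reach-source r') refl)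

  reach?-bounded : (k : ℕ) → (m : Mask) → size m ≤ k → ∀ u v → Dec (Reach (induced m) u v)
  reach?-bounded k m c u v with T? (m u)
  ... | no nmu = no (λ r → nmu (Reach-source r))
  ... | yes mu with u ≟ v
  ...   | yes refl = yes (here mu)
  ...   | no u≢v with k
  ...     | zero = ⊥-elim (ℕP.n≮0 (ℕP.<-≤-trans (size-remove m u mu) c))
  ...     | suc k' with any? (λ y → Adj? u y ×-dec reach?-bounded k' (remove u m)
                 (ℕP.≤-pred (ℕP.<-≤-trans (size-remove m u mu) c)) y v)
  ...       | yes (y , e , r) = yes (step (mu , remove⊆ u m y (Reach-source r) , e) (Reach-mono (induced-remove⊆ u m) r))
  ...       | no nq = no (λ r → nq (Reach-last-exit m u r u≢v))

  reach? : ∀ m u v → Dec (Reach (induced m) u v)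
  reach? m u v = reach?-bounded (size m) m ℕP.≤-refl u v

  avoid : V → Mask
  avoid z = remove z (λ _ → true)

  avoid⁺ : ∀ z x → x ≢ z → T (avoid z x)
  avoid⁺ z x ne = remove⁺ z _ x tt ne

  avoid⁻ : ∀ z x → T (avoid z x) → x ≢ z
  avoid⁻ z x p = remove-≢ z _ x p

  avoid⇒deleted : ∀ {z u w} → Reach (induced (avoid z)) u w → Reach (whole {G} -ᵛ z) u w
  avoid⇒deleted {z} = Reach-mono ((λ x p → tt , avoid⁻ z x p) ,
     (λ { x y (a , b , e) → e , avoid⁻ z x a , avoid⁻ z y b }))

  deleted⇒avoid : ∀ {z u w} → Reach (whole {G} -ᵛ z) u w → Reach (induced (avoid z)) u w
  deleted⇒avoid {z} = Reach-mono ((λ x p → avoid⁺ z x (proj₂ p)) ,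
     (λ { x y (e , a , b) → avoid⁺ z x a , avoid⁺ z y b , e }))

  Reach⇒avoid : ∀ {H : Subgraph G} {z} → (∀ x → inV H x → x ≢ z) → ∀ {u w} → Reach H u w → Reach (induced (avoid z)) u w
  Reach⇒avoid {H} {z} f = Reach-mono ((λ x p → avoid⁺ z x (f x p)) ,
     (λ x y e → avoid⁺ z x (f x (proj₁ (inE-V H e))) , avoid⁺ z y (f y (proj₂ (inE-V H e))) , inE-adj H e))

  Art : V → Set
  Art = ArticulationVertex {G}

  Art-intro : ∀ {x y t} → y ≢ x → t ≢ x → ¬ Reach (induced (avoid x)) y t → Art x
  Art-intro {x} {y} {t} p q nr = tt , y , t , (tt , p) , (tt , q) , (λ r → nr (deleted⇒avoid r))

  ¬Art⇒Reach : ∀ {x y t} → ¬ Art x → y ≢ x → t ≢ x → Reach (induced (avoid x)) y t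
  ¬Art⇒Reach {x} {y} {t} na p q with reach? (avoid x) y t
  ... | yes r = r
  ... | no nr = ⊥-elim (na (Art-intro p q nr))

  Chain : List V → Set
  Chain [] = ⊤
  Chain (x ∷ []) = ⊤
  Chain (x ∷ y ∷ r) = A x y × Chain (y ∷ r)

  Path : List V → Set
  Path P = Chain P × Uniq P

  Chain-ʳ++ : ∀ {x} xs ys → Chain (x ∷ xs) → Chain (x ∷ ys) → Chain (xs ʳ++ x ∷ ys)
  Chain-ʳ++ [] ys cx cy = cy
  Chain-ʳ++ {x} (a ∷ xs) ys (e , cx) cy = Chain-ʳ++ xs (x ∷ ys) cx (Adj-sym e , cy)

  Chain-ʳ++⁻ : ∀ {x} xs ys → Chain (xs ʳ++ x ∷ ys) → Chain (x ∷ xs) × Chain (x ∷ ys)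
  Chain-ʳ++⁻ [] ys c = tt , c
  Chain-ʳ++⁻ {x} (a ∷ xs) ys c with Chain-ʳ++⁻ xs (x ∷ ys) c
  ... | cx , (e , cy) = (Adj-sym e , cx) , cy

  Chain-++ : ∀ {x y} xs ys → Chain (x ∷ xs) → A (lastOf x xs) y → Chain (y ∷ ys) → Chain (x ∷ xs ++ y ∷ ys)
  Chain-++ [] ys cx e cy = e , cy
  Chain-++ (a ∷ xs) ys (e' , cx) e cy = e' , Chain-++ xs ys cx e cy

  Chain-++⁻ : ∀ {x y} xs ys → Chain (x ∷ xs ++ y ∷ ys) → Chain (x ∷ xs) × A (lastOf x xs) y × Chain (y ∷ ys)
  Chain-++⁻ [] ys (e , cy) = tt , e , cy
  Chain-++⁻ (a ∷ xs) ys (e' , c) with Chain-++⁻ xs ys c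
  ... | cx , e , cy = (e' , cx) , e , cy

  Chain-tail : ∀ {x} xs → Chain (x ∷ xs) → Chain xs
  Chain-tail [] c = tt
  Chain-tail (a ∷ xs) (e , c) = c

  Chain⇒Reach : ∀ m {x} xs → Chain (x ∷ xs) → (∀ y → y ∈ x ∷ xs → T (m y)) → Reach (induced m) x (lastOf x xs)
  Chain⇒Reach m {x} [] c f = here (f x (here refl))
  Chain⇒Reach m {x} (a ∷ xs) (e , c) f = step (f x (here refl) , f a (there (here refl)) , e)
                                              (Chain⇒Reach m xs c (λ y p → f y (there p)))

  Chain-prefix : ∀ xs ys → Chain (xs ++ ys) → Chain xs
  Chain-prefix [] ys c = tt
  Chain-prefix (x ∷ []) ys c = tt
  Chain-prefix (x ∷ y ∷ xs) ys (e , c) = e , Chain-prefix (y ∷ xs) ys c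

  Chain? : ∀ xs → Dec (Chain xs)
  Chain? [] = yes tt
  Chain? (x ∷ []) = yes tt
  Chain? (x ∷ y ∷ r) = Adj? x y ×-dec Chain? (y ∷ r)

  Uniq? : ∀ xs → Dec (Uniq xs)
  Uniq? [] = yes tt
  Uniq? (x ∷ r) = ¬? (x ∈? r) ×-dec Uniq? r

  Path? : ∀ xs → Dec (Path xs)
  Path? xs = Chain? xs ×-dec Uniq? xs

  lookup-Chain : ∀ (P : List V) → Chain P → ∀ i j → suc (toℕ i) ≡ toℕ j → A (Data.List.lookup P i) (Data.List.lookup P j)
  lookup-Chain (x ∷ y ∷ r) (e , c) fz (fs fz) _ = e
  lookup-Chain (x ∷ y ∷ r) (e , c) fz (fs (fs j)) ()
  lookup-Chain (x ∷ y ∷ r) (e , c) (fs i) (fs j) eq = lookup-Chain (y ∷ r) c i j (ℕP.suc-injective eq)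
  lookup-Chain (x ∷ []) c fz fz ()
  lookup-Chain (x ∷ y ∷ r) c i fz ()

  SpanningPath⇒Traceable : ∀ P → Path P → (∀ v → v ∈ P) → Traceable G
  SpanningPath⇒Traceable P (chain , unique) spans = p , p-injective , p-surjective , p-adjacent
    where
      index-injective : ∀ {v w} → Any.index (spans v) ≡ Any.index (spans w) → v ≡ w
      index-injective {v} {w} e =
        trans (AnyP.lookup-index (spans v)) (trans (cong (Data.List.lookup P) e) (esym (AnyP.lookup-index (spans w))))
      eq : length P ≡ n G
      eq = ℕP.≤-antisym (Uniq-length≤ P unique) (FP.injective⇒≤ index-injective)
      p : Fin (n G) → V
      p i = Data.List.lookup P (F.cast (esym eq) i)
      p-injective : ∀ i j → p i ≡ p j → i ≡ j
      p-injective i j e = trans (esym (FP.cast-involutive eq (esym eq) i))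
        (trans (cong (F.cast eq) (lookup-injective P unique _ _ e)) (FP.cast-involutive eq (esym eq) j))
      p-surjective : ∀ v → ∃ λ i → p i ≡ v
      p-surjective v = F.cast eq (Any.index (spans v)) ,
        trans (cong (Data.List.lookup P) (FP.cast-involutive (esym eq) eq _)) (esym (AnyP.lookup-index (spans v)))
      p-adjacent : ∀ i j → suc (toℕ i) ≡ toℕ j → A (p i) (p j)
      p-adjacent i j e = lookup-Chain P chain _ _
        (trans (cong suc (FP.toℕ-cast (esym eq) i)) (trans e (esym (FP.toℕ-cast (esym eq) j))))

  Chain-suffix : ∀ xs ys → Chain (xs ++ ys) → Chain ys
  Chain-suffix [] ys c = c
  Chain-suffix (x ∷ xs) ys c = Chain-suffix xs ys (Chain-tail (xs ++ ys) c)

  tabulate-Chain : ∀ {k} (f : Fin k → V) → (∀ i j → suc (toℕ i) ≡ toℕ j → A (f i) (f j)) → Chain (Data.List.tabulate f)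
  tabulate-Chain {zero} f h = tt
  tabulate-Chain {suc zero} f h = tt
  tabulate-Chain {suc (suc k)} f h = h fz (fs fz) refl , tabulate-Chain (λ i → f (fs i)) (λ i j e → h (fs i) (fs j) (cong suc e))

  tabulate-Uniq : ∀ {k} (f : Fin k → V) → (∀ i j → f i ≡ f j → i ≡ j) → Uniq (Data.List.tabulate f)
  tabulate-Uniq {zero} f h = tt
  tabulate-Uniq {suc k} f h = (λ q → let (i , e) = ∈-tabulate⁻ q in fznfs (h fz (fs i) e)) ,
                         tabulate-Uniq (λ i → f (fs i)) (λ i j e → FP.suc-injective (h (fs i) (fs j) e))
    where fznfs : ∀ {i : Fin k} → fz ≢ fs i
          fznfs ()

  Traceable⇒SpanningPath : Traceable G → ∃ λ P → Path P × (∀ v → v ∈ P)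
  Traceable⇒SpanningPath (f , f-injective , f-surjective , f-adjacent) =
    Data.List.tabulate f , (tabulate-Chain f f-adjacent , tabulate-Uniq f f-injective) , spans
    where
      spans : ∀ v → v ∈ Data.List.tabulate f
      spans v with f-surjective v
      ... | i , refl = ∈-tabulate⁺ i

  Consecutive-Adj : ∀ Xs {u w} → Chain Xs → Consecutive Xs u w → A u w
  Consecutive-Adj (x ∷ y ∷ r) (e , c) (inj₁ (refl , refl)) = e
  Consecutive-Adj (x ∷ y ∷ r) (e , c) (inj₂ z) = Consecutive-Adj (y ∷ r) c z

  Consecutive-reach-head : ∀ (K : Subgraph G) h Tl → (∀ u w → Consecutive (h ∷ Tl) u w → inE K u w) → (∀ s → s ∈ h ∷ Tl → inV K s) →
             ∀ y → y ∈ h ∷ Tl → Reach K y h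
  Consecutive-reach-head K h Tl fe fv y (here refl) = here (fv h (here refl))
  Consecutive-reach-head K h (h' ∷ Tl) fe fv y (there q) =
    Reach-snoc (Consecutive-reach-head K h' Tl (λ u w z → fe u w (inj₂ z)) (λ s p → fv s (there p)) y q)
           (inE-sym K (fe h h' (inj₁ (refl , refl))))

  Consecutive-connected : ∀ (K : Subgraph G) Xs → (∀ u w → Consecutive Xs u w → inE K u w) → (∀ s → s ∈ Xs → inV K s) →
              ∀ y y' → y ∈ Xs → y' ∈ Xs → Reach K y y'
  Consecutive-connected K (h ∷ Tl) fe fv y y' p p' = Reach-trans (Consecutive-reach-head K h Tl fe fv y p) (Reach-sym (Consecutive-reach-head K h Tl fe fv y' p'))

  Chain-connected : ∀ m Xs → Chain Xs → (∀ q → q ∈ Xs → T (m q)) → ∀ y y' → y ∈ Xs → y' ∈ Xs → Reach (induced m) y y'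
  Chain-connected m Xs c f = Consecutive-connected (induced m) Xs
    (λ u w z → f u (proj₁ (Consecutive-∈ Xs z)) , f w (proj₂ (Consecutive-∈ Xs z)) , Consecutive-Adj Xs c z) f

  -- The block of an edge

  module EdgeBlock (u0 v0 : V) (e0 : A u0 v0) where
    IsEnd : V → Set
    IsEnd t = t ≡ u0 ⊎ t ≡ v0

    ReachesEnd : V → V → Set
    ReachesEnd z x = Reach (induced (avoid z)) x u0 ⊎ Reach (induced (avoid z)) x v0

    -- The block of the edge u0 v0, described by separation: x belongs to it when
    -- no vertex z ≠ x separates x from the edge. block-isBlock shows this is a block.
    InBlock : V → Set
    InBlock x = ∀ z → z ≢ x → ReachesEnd z x

    u0≢v0 : u0 ≢ v0
    u0≢v0 = Adj⇒≢ e0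

    InBlock-u0 : InBlock u0
    InBlock-u0 z ne = inj₁ (here (avoid⁺ z u0 (λ e → ne (esym e))))

    InBlock-v0 : InBlock v0
    InBlock-v0 z ne = inj₂ (here (avoid⁺ z v0 (λ e → ne (esym e))))

    InBlock-extend : ∀ {x y} → InBlock x → A x y → ReachesEnd x y → InBlock y
    InBlock-extend {x} {y} sx e rt z z≢y with z ≟ x
    ... | yes refl = rt
    ... | no z≢x with sx z z≢x
    ...   | inj₁ r = inj₁ (step (avoid⁺ z y (λ q → z≢y (esym q)) , Reach-source r , Adj-sym e) r)
    ...   | inj₂ r = inj₂ (step (avoid⁺ z y (λ q → z≢y (esym q)) , Reach-source r , Adj-sym e) r)

    block : Subgraph G
    block = record
      { inV = InBlock
      ; inE = λ x y → InBlock x × InBlock y × A x y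
      ; inE-sym = λ { (a , b , e) → b , a , Adj-sym e }
      ; inE-adj = λ { (a , b , e) → e }
      ; inE-V = λ { (a , b , e) → a , b }
      }

    InBlock-step : ∀ {x y} → ¬ Art x → InBlock x → A x y → InBlock y
    InBlock-step {x} {y} na sx e with x ≟ u0
    ... | yes refl = InBlock-extend sx e (inj₂ (¬Art⇒Reach na (λ q → Adj⇒≢ e (esym q)) (λ q → u0≢v0 (esym q))))
    ... | no x≢u0 = InBlock-extend sx e (inj₁ (¬Art⇒Reach na (λ q → Adj⇒≢ e (esym q)) (λ q → x≢u0 (esym q))))

    walk-in-block-bounded : ∀ k m v {x t} → size m ≤ k → (∀ y → T (m y) → y ≢ v) → InBlock x →
        Reach (induced m) x t → IsEnd t → Reach (block -ᵛ v) x t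
    walk-in-block-bounded k m v {x} {t} c f sx r tg with x ≟ t
    ... | yes refl = here (sx , f x (Reach-source r))
    ... | no x≢t with Reach-last-exit m x r x≢t | k
    ...   | y , e , r' | zero = ⊥-elim (ℕP.n≮0 (ℕP.<-≤-trans (size-remove m x (Reach-source r)) c))
    ...   | y , e , r' | suc k' =
            let my = remove⊆ x m y (Reach-source r')
                rt : ReachesEnd x y
                rt = reachesEnd tg r'
                sy = InBlock-extend sx e rt
            in step ((sx , sy , e) , f x (Reach-source r) , f y my)
                    (walk-in-block-bounded k' (remove x m) v (ℕP.≤-pred (ℕP.<-≤-trans (size-remove m x (Reach-source r)) c))
                       (λ w p → f w (remove⊆ x m w p)) sy r' tg)
      where
        sub : induced (remove x m) ⊆ᴳ induced (avoid x)
        reachesEnd : ∀ {y} → IsEnd t → Reach (induced (remove x m)) y t → ReachesEnd x y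
        reachesEnd (inj₁ refl) r' = inj₁ (Reach-mono sub r')
        reachesEnd (inj₂ refl) r' = inj₂ (Reach-mono sub r')
        sub = (λ w p → avoid⁺ x w (remove-≢ x m w p)) ,
              (λ { w w' (a , b , e) → avoid⁺ x w (remove-≢ x m w a) , avoid⁺ x w' (remove-≢ x m w' b) , e })

    walk-in-block : ∀ v {x t} → InBlock x → Reach (induced (avoid v)) x t → IsEnd t → Reach (block -ᵛ v) x t
    walk-in-block v sx r tg = walk-in-block-bounded _ (avoid v) v ℕP.≤-refl (avoid⁻ v) sx r tg

    reach-end : ∀ v {x} → InBlock x → x ≢ v → ∃ λ t → IsEnd t × Reach (block -ᵛ v) x t
    reach-end v sx x≢v with sx v (λ q → x≢v (esym q))
    ... | inj₁ r = u0 , inj₁ refl , walk-in-block v sx r (inj₁ refl)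
    ... | inj₂ r = v0 , inj₂ refl , walk-in-block v sx r (inj₂ refl)

    edge-avoiding : ∀ v → u0 ≢ v → v0 ≢ v → Reach (block -ᵛ v) u0 v0
    edge-avoiding v p q = step ((InBlock-u0 , InBlock-v0 , e0) , p , q) (here (InBlock-v0 , q))

    join-at-ends : ∀ v {x y t t'} → IsEnd t → IsEnd t' → Reach (block -ᵛ v) x t → Reach (block -ᵛ v) y t' → Reach (block -ᵛ v) x y
    join-at-ends v (inj₁ refl) (inj₁ refl) r r' = Reach-trans r (Reach-sym r')
    join-at-ends v (inj₂ refl) (inj₂ refl) r r' = Reach-trans r (Reach-sym r')
    join-at-ends v (inj₁ refl) (inj₂ refl) r r' =
      Reach-trans r (Reach-trans (edge-avoiding v (λ q → proj₂ (Reach-target r) q) (λ q → proj₂ (Reach-target r') q)) (Reach-sym r'))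
    join-at-ends v (inj₂ refl) (inj₁ refl) r r' =
      Reach-trans r (Reach-trans (Reach-sym (edge-avoiding v (λ q → proj₂ (Reach-target r') q) (λ q → proj₂ (Reach-target r) q))) (Reach-sym r'))

    block-avoiding-connected : ∀ v {x y} → InBlock x → x ≢ v → InBlock y → y ≢ v → Reach (block -ᵛ v) x y
    block-avoiding-connected v sx xv sy yv with reach-end v sx xv | reach-end v sy yv
    ... | t , tg , r | t' , tg' , r' = join-at-ends v tg tg' r r'

    block-noArticulation : NoArticulation block
    block-noArticulation v (sv , a , b , (sa , av') , (sb , bv) , nr) = nr (block-avoiding-connected v sa av' sb bv)

    block-delete⊆ : ∀ v → (block -ᵛ v) ⊆ᴳ block
    block-delete⊆ v = (λ _ p → proj₁ p) , (λ _ _ p → proj₁ p)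

    block-reach-u0 : ∀ {x} → InBlock x → Reach block x u0
    block-reach-u0 {x} sx with x ≟ u0
    ... | yes refl = here sx
    ... | no x≢u0 with sx u0 (λ q → x≢u0 (esym q))
    ...   | inj₁ r = ⊥-elim (avoid⁻ u0 u0 (Reach-target r) refl)
    ...   | inj₂ r = Reach-snoc (Reach-mono (block-delete⊆ u0) (walk-in-block u0 sx r (inj₂ refl))) (InBlock-v0 , InBlock-u0 , Adj-sym e0)

    block-connected : Connected block
    block-connected = (u0 , InBlock-u0) , λ x y sx sy → Reach-trans (block-reach-u0 sx) (Reach-sym (block-reach-u0 sy))

    block-maximal : ∀ (H : Subgraph G) → block ⊆ᴳ H → Connected H → NoArticulation H → H ⊆ᴳ block
    block-maximal H (fv , fe) cH naH = vs , (λ x y e → vs x (proj₁ (inE-V H e)) , vs y (proj₂ (inE-V H e)) , inE-adj H e)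
      where
        core : ∀ w z t → inV H w → z ≢ w → inV H t → t ≢ z → ¬ Reach (induced (avoid z)) w t → ⊥
        core w z t hw zw ht tz nr = nr (Reach⇒avoid (λ x p q → nz (subst (inV H) q p)) (proj₂ cH w t hw ht))
          where
            nz : ¬ inV H z
            nz hz = naH z (hz , w , t , (hw , λ q → zw (esym q)) , (ht , tz) ,
                     (λ r → nr (Reach⇒avoid (λ x p → proj₂ p) r)))
        vs : ∀ w → inV H w → InBlock w
        vs w hw z zw with reach? (avoid z) w u0 ⊎-dec reach? (avoid z) w v0
        ... | yes r = r
        ... | no nr with z ≟ u0
        ...   | yes refl = ⊥-elim (core w z v0 hw zw (fv v0 InBlock-v0) (λ q → u0≢v0 (esym q)) (λ r → nr (inj₂ r)))
        ...   | no zu = ⊥-elim (core w z u0 hw zw (fv u0 InBlock-u0) (λ q → zu (esym q)) (λ r → nr (inj₁ r)))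

    block-isBlock : IsBlock block
    block-isBlock = block-connected , block-noArticulation , block-maximal

    cycle⊆InBlock : ∀ rest → Chain (v0 ∷ rest) → Uniq (u0 ∷ v0 ∷ rest) → A (lastOf v0 rest) u0 →
               ∀ x → x ∈ rest → InBlock x
    cycle⊆InBlock rest c u eu x xin with ∈-∃++ xin
    ... | R1 , R2 , refl = λ z zx → either-way z zx (z ∈? (v0 ∷ R1))
      where
        u0∉ : u0 ∉ v0 ∷ R1 ++ x ∷ R2
        u0∉ = proj₁ u
        dj : Disjoint (v0 ∷ R1) (x ∷ R2)
        dj = proj₂ (proj₂ (Uniq-++⁻ (v0 ∷ R1) (x ∷ R2) (proj₂ u)))
        cs = Chain-++⁻ {v0} {x} R1 R2 c
        either-way : ∀ z → z ≢ x → Dec (z ∈ v0 ∷ R1) → ReachesEnd z x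
        either-way z zx (yes zin) = inj₁ (Reach-snoc (Chain⇒Reach (avoid z) R2 (proj₂ (proj₂ cs))
                              (λ y yin → avoid⁺ z y (∈∧∉⇒≢ zin (λ q → dj y q yin))))
                              (avoid⁺ z (lastOf x R2) (∈∧∉⇒≢ zin (λ q → dj _ q (lastOf-∈ x R2))) ,
                               avoid⁺ z u0 (∈∧∉⇒≢ zin (λ q → u0∉ (∈-++⁺ˡ {ys = x ∷ R2} q))) ,
                               subst (λ t → A t u0) (lastOf-++ v0 R1 x R2) eu))
        either-way z zx (no znin) = inj₂ (Reach-sym (Reach-snoc (Chain⇒Reach (avoid z) R1 (proj₁ cs)
                              (λ y yin → avoid⁺ z y (λ q → znin (subst (_∈ v0 ∷ R1) q yin))))
                              (avoid⁺ z _ (λ q → znin (subst (_∈ v0 ∷ R1) q (lastOf-∈ v0 R1))) ,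
                               avoid⁺ z x (λ q → zx (esym q)) , proj₁ (proj₂ cs))))

  Cs : ∀ {k} → Fin k → Fin k → Set
  Cs = CycSucc {G}

  CycSucc-functional : ∀ {k} → ∀ {i j j' : Fin k} → Cs i j → Cs i j' → j ≡ j'
  CycSucc-functional (inj₁ a) (inj₁ b) = FP.toℕ-injective (trans (esym a) b)
  CycSucc-functional {j = j} (inj₁ a) (inj₂ (b , _)) = ⊥-elim (ℕP.<-irrefl (trans (esym a) b) (FP.toℕ<n j))
  CycSucc-functional {j' = j'} (inj₂ (a , _)) (inj₁ b) = ⊥-elim (ℕP.<-irrefl (trans (esym b) a) (FP.toℕ<n j'))
  CycSucc-functional (inj₂ (_ , a)) (inj₂ (_ , b)) = FP.toℕ-injective (trans a (esym b))

  CycSucc-injective : ∀ {k} → ∀ {i i' j : Fin k} → Cs i j → Cs i' j → i ≡ i'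
  CycSucc-injective (inj₁ a) (inj₁ b) = FP.toℕ-injective (ℕP.suc-injective (trans a (esym b)))
  CycSucc-injective (inj₁ a) (inj₂ (_ , b)) with trans a b
  ... | ()
  CycSucc-injective (inj₂ (_ , a)) (inj₁ b) with trans b a
  ... | ()
  CycSucc-injective (inj₂ (a , _)) (inj₂ (b , _)) = FP.toℕ-injective (ℕP.suc-injective (trans a (esym b)))

  CycSucc-successor : ∀ {k} → k ≥ 3 → ∀ (t : Fin k) → ∃ λ j → Cs t j
  CycSucc-successor {k} (s≤s _) t with suc (toℕ t) ℕP.≟ k
  ... | yes e = fz , inj₂ (e , refl)
  ... | no ne = F.fromℕ< (ℕP.≤∧≢⇒< (FP.toℕ<n t) ne) , inj₁ (esym (FP.toℕ-fromℕ< (ℕP.≤∧≢⇒< (FP.toℕ<n t) ne)))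

  CycSucc-predecessor : ∀ {k} → ∀ (t : Fin k) → ∃ λ j → Cs j t
  CycSucc-predecessor {suc k'} fz = F.fromℕ k' , inj₂ (cong suc (FP.toℕ-fromℕ k') , refl)
  CycSucc-predecessor {suc k'} (fs t) = F.inject₁ t , inj₁ (cong suc (FP.toℕ-inject₁ t))

  ≥3⇒≢2 : ∀ {k} → k ≥ 3 → k ≢ 2
  ≥3⇒≢2 (s≤s (s≤s ())) refl

  ≥3⇒≢1 : ∀ {k} → k ≥ 3 → k ≢ 1
  ≥3⇒≢1 (s≤s ()) refl

  CycSucc-asym : ∀ {k} → k ≥ 3 → ∀ {i j : Fin k} → Cs i j → Cs j i → ⊥
  CycSucc-asym k≥3 {i} {j} (inj₁ a) (inj₁ b) = ℕP.<-irrefl (esym (trans (cong suc a) b)) (ℕP.m≤n⇒m≤1+n (ℕP.n<1+n (toℕ i)))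
  CycSucc-asym k≥3 {i} {j} (inj₁ a) (inj₂ (b , c)) =
    ≥3⇒≢2 k≥3 (esym (trans (cong suc (trans (cong suc (esym c)) a)) b))
  CycSucc-asym k≥3 {i} {j} (inj₂ (a , c)) (inj₁ b) =
    ≥3⇒≢2 k≥3 (esym (trans (cong suc (trans (cong suc (esym c)) b)) a))
  CycSucc-asym k≥3 {i} {j} (inj₂ (a , c)) (inj₂ (b , d)) =
    ≥3⇒≢1 k≥3 (esym (trans (cong suc (esym d)) a))

  module SimpleCycle (C : Subgraph G) (cy : IsSimpleCycle C) where
    k : ℕ
    k = proj₁ cy
    c : Fin k → V
    c = proj₁ (proj₂ cy)
    k≥3 : k ≥ 3
    k≥3 = proj₁ (proj₂ (proj₂ cy))
    c-injective : ∀ i j → c i ≡ c j → i ≡ j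
    c-injective = proj₁ (proj₂ (proj₂ (proj₂ cy)))
    vertex-on-cycle : ∀ u → inV C u ⇔ (∃ λ i → c i ≡ u)
    vertex-on-cycle = proj₁ (proj₂ (proj₂ (proj₂ (proj₂ cy))))
    edge-on-cycle : ∀ u w → inE C u w ⇔ (∃ λ i → ∃ λ j → (Cs i j × ((u ≡ c i × w ≡ c j) ⊎ (u ≡ c j × w ≡ c i))))
    edge-on-cycle = proj₂ (proj₂ (proj₂ (proj₂ (proj₂ cy))))

    CycleNeighbour : Fin k → V → Set
    CycleNeighbour t y = (∃ λ j → Cs t j × y ≡ c j) ⊎ (∃ λ j → Cs j t × y ≡ c j)

    edge⇒CycleNeighbour : ∀ {x y t} → inE C x y → x ≡ c t → CycleNeighbour t y
    edge⇒CycleNeighbour {x} {y} {t} e xt with Equivalence.to (edge-on-cycle x y) e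
    ... | i , j , cs , inj₁ (a , b) with c-injective _ _ (trans (esym a) xt)
    ...   | refl = inj₁ (j , cs , b)
    edge⇒CycleNeighbour {x} {y} {t} e xt | i , j , cs , inj₂ (a , b) with c-injective _ _ (trans (esym a) xt)
    ...   | refl = inj₂ (i , cs , b)

    position : ∀ {x} → inV C x → ∃ λ t → x ≡ c t
    position {x} p with Equivalence.to (vertex-on-cycle x) p
    ... | t , e = t , esym e

    successor-unique : ∀ {t y1 y2} → (∃ λ j → Cs t j × y1 ≡ c j) → (∃ λ j → Cs t j × y2 ≡ c j) → y1 ≡ y2
    successor-unique (j , a , b) (j' , a' , b') = trans b (trans (cong c (CycSucc-functional a a')) (esym b'))
    predecessor-unique : ∀ {t y1 y2} → (∃ λ j → Cs j t × y1 ≡ c j) → (∃ λ j → Cs j t × y2 ≡ c j) → y1 ≡ y2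
    predecessor-unique (j , a , b) (j' , a' , b') = trans b (trans (cong c (CycSucc-injective a a')) (esym b'))

    at-most-two-neighbours : ∀ {x y1 y2 y3} → inE C x y1 → inE C x y2 → inE C x y3 →
         y1 ≢ y2 → y1 ≢ y3 → y2 ≢ y3 → ⊥
    at-most-two-neighbours {x} e1 e2 e3 n12 n13 n23 with position (proj₁ (inE-V C e1))
    ... | t , xt with edge⇒CycleNeighbour e1 xt | edge⇒CycleNeighbour e2 xt | edge⇒CycleNeighbour e3 xt
    ... | inj₁ a | inj₁ b | _ = n12 (successor-unique a b)
    ... | inj₂ a | inj₂ b | _ = n12 (predecessor-unique a b)
    ... | inj₁ a | inj₂ b | inj₁ d = n13 (successor-unique a d)
    ... | inj₁ a | inj₂ b | inj₂ d = n23 (predecessor-unique b d)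
    ... | inj₂ a | inj₁ b | inj₁ d = n23 (successor-unique b d)
    ... | inj₂ a | inj₁ b | inj₂ d = n13 (predecessor-unique a d)

    other-neighbour : ∀ {x y} → inE C x y → ∃ λ y' → inE C x y' × y' ≢ y
    other-neighbour {x} {y} e with position (proj₁ (inE-V C e))
    ... | t , xt with edge⇒CycleNeighbour e xt
    ... | inj₁ (j , a , b) with CycSucc-predecessor t
    ...   | p , cp = c p , Equivalence.from (edge-on-cycle x (c p)) (p , t , cp , inj₂ (xt , refl)) ,
                     (λ q → CycSucc-asym k≥3 a (subst (λ z → Cs z t) (c-injective _ _ (trans q b)) cp))
    other-neighbour {x} {y} e | t , xt | inj₂ (j , a , b) with CycSucc-successor k≥3 t
    ...   | s , cs' = c s , Equivalence.from (edge-on-cycle x (c s)) (t , s , cs' , inj₁ (xt , refl)) ,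
                     (λ q → CycSucc-asym k≥3 a (subst (λ z → Cs t z) (c-injective _ _ (trans q b)) cs'))

  module SingleEdge (C : Subgraph G) (se : IsSingleEdge C) where
    end₁ : V
    end₁ = proj₁ se
    end₂ : V
    end₂ = proj₁ (proj₂ se)
    vertex-is-end : ∀ u → inV C u → u ≡ end₁ ⊎ u ≡ end₂
    vertex-is-end u p = Equivalence.to (proj₁ (proj₂ (proj₂ (proj₂ se))) u) p
    ends-edge : ∀ u w → ((u ≡ end₁ × w ≡ end₂) ⊎ (u ≡ end₂ × w ≡ end₁)) → inE C u w
    ends-edge u w p = Equivalence.from (proj₂ (proj₂ (proj₂ (proj₂ se))) u w) p

    no-three-vertices : ∀ {x y z} → inV C x → inV C y → inV C z → x ≢ y → x ≢ z → y ≢ z → ⊥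
    no-three-vertices {x} {y} {z} px py pz nxy nxz nyz with vertex-is-end x px | vertex-is-end y py | vertex-is-end z pz
    ... | inj₁ a | inj₁ b | _ = nxy (trans a (esym b))
    ... | inj₂ a | inj₂ b | _ = nxy (trans a (esym b))
    ... | inj₁ a | inj₂ b | inj₁ d = nxz (trans a (esym d))
    ... | inj₁ a | inj₂ b | inj₂ d = nyz (trans b (esym d))
    ... | inj₂ a | inj₁ b | inj₁ d = nyz (trans b (esym d))
    ... | inj₂ a | inj₁ b | inj₂ d = nxz (trans a (esym d))

    distinct⇒edge : ∀ {x y} → inV C x → inV C y → x ≢ y → inE C x y
    distinct⇒edge {x} {y} px py nxy with vertex-is-end x px | vertex-is-end y py
    ... | inj₁ a | inj₁ b = ⊥-elim (nxy (trans a (esym b)))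
    ... | inj₂ a | inj₂ b = ⊥-elim (nxy (trans a (esym b)))
    ... | inj₁ a | inj₂ b = ends-edge x y (inj₁ (a , b))
    ... | inj₂ a | inj₁ b = ends-edge x y (inj₂ (a , b))

  module Components (m : Mask) where
    Separated : List V → Set
    Separated [] = ⊤
    Separated (x ∷ R) = (∀ r → r ∈ R → ¬ Reach (induced m) x r) × Separated R

    Separated-lookup : ∀ R → Separated R → ∀ i j → Reach (induced m) (Data.List.lookup R i) (Data.List.lookup R j) → i ≡ j
    Separated-lookup (x ∷ R) s fz fz r = refl
    Separated-lookup (x ∷ R) s fz (fs j) r = ⊥-elim (proj₁ s _ (∈-lookup {xs = R} j) r)
    Separated-lookup (x ∷ R) s (fs i) fz r = ⊥-elim (proj₁ s _ (∈-lookup {xs = R} i) (Reach-sym r))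
    Separated-lookup (x ∷ R) s (fs i) (fs j) r = cong fs (Separated-lookup R (proj₂ s) i j r)

    Represents : List V → List V → Set
    Represents xs R = Separated R × (∀ r → r ∈ R → T (m r)) × (∀ x → x ∈ xs → T (m x) → ∃ λ r → r ∈ R × Reach (induced m) x r)

    representatives : ∀ xs R → Separated R → (∀ r → r ∈ R → T (m r)) →
           ∃ λ R' → Represents xs R' × (∀ r → r ∈ R → r ∈ R')
    representatives [] R s im = R , (s , im , (λ _ ())) , (λ r p → p)
    representatives (x ∷ xs) R s im with T? (m x) | Any.any? (λ r → reach? m x r) R
    ... | no nmx | _ with representatives xs R s im
    ...   | R' , (s' , im' , cv) , sub = R' , (s' , im' , covers) , sub
      where covers : ∀ y → y ∈ x ∷ xs → T (m y) → ∃ λ r → r ∈ R' × Reach (induced m) y r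
            covers y (here refl) my = ⊥-elim (nmx my)
            covers y (there p) my = cv y p my
    representatives (x ∷ xs) R s im | yes mx | yes anyr with representatives xs R s im | find anyr
    ...   | R' , (s' , im' , cv) , sub | r , rin , xr = R' , (s' , im' , covers) , sub
      where covers : ∀ y → y ∈ x ∷ xs → T (m y) → ∃ λ r → r ∈ R' × Reach (induced m) y r
            covers y (here refl) my = r , sub r rin , xr
            covers y (there p) my = cv y p my
    representatives (x ∷ xs) R s im | yes mx | no nany with representatives xs (x ∷ R) ((λ r rin xr → nany (lose rin xr)) , s)
                                                   (λ { r (here refl) → mx ; r (there p) → im r p })
    ...   | R' , (s' , im' , cv) , sub = R' , (s' , im' , covers) , (λ r p → sub r (there p))
      where covers : ∀ y → y ∈ x ∷ xs → T (m y) → ∃ λ r → r ∈ R' × Reach (induced m) y r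
            covers y (here refl) my = x , sub x (here refl) , here mx
            covers y (there p) my = cv y p my

  three-components : ∀ p {x y z} → x ≢ p → y ≢ p → z ≢ p →
    ¬ Reach (induced (avoid p)) x y → ¬ Reach (induced (avoid p)) x z → ¬ Reach (induced (avoid p)) y z →
    ∃ λ k → NumComponents (whole {G} -ᵛ p) k × 3 ≤ k
  three-components p {x} {y} {z} xp yp zp nxy nxz nyz with Components.representatives (avoid p) (Data.List.allFin (n G)) [] tt (λ _ ())
  ... | R , (s , im , cv) , _ =
      length R , (r , (λ i → tt , avoid⁻ p _ (im _ (∈-lookup {xs = R} i))) ,
                  (λ i j q → Components.Separated-lookup (avoid p) R s i j (deleted⇒avoid q)) ,
                  (λ u hu → let (i , q) = cov u (proj₂ hu) in i , avoid⇒deleted q)) ,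
      three-distinct⇒3≤ ix iy iz (λ e → nxy (joined qx qy e)) (λ e → nxz (joined qx qz e)) (λ e → nyz (joined qy qz e))
    where
      r : Fin (length R) → V
      r = Data.List.lookup R
      cov : ∀ u → u ≢ p → ∃ λ i → Reach (induced (avoid p)) u (r i)
      cov u up with cv u (∈-allFin u) (avoid⁺ p u up)
      ... | t , tin , q = Any.index tin , subst (Reach (induced (avoid p)) u) (AnyP.lookup-index tin) q
      ix = proj₁ (cov x xp)
      qx = proj₂ (cov x xp)
      iy = proj₁ (cov y yp)
      qy = proj₂ (cov y yp)
      iz = proj₁ (cov z zp)
      qz = proj₂ (cov z zp)
      joined : ∀ {a b i j} → Reach (induced (avoid p)) a (r i) → Reach (induced (avoid p)) b (r j) → i ≡ j → Reach (induced (avoid p)) a b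
      joined qa qb refl = Reach-trans qa (Reach-sym qb)

  -- A path through p as two arms hanging off p, read as reverse As ++ p ∷ Bs.
  Arms : List V → V → List V → Set
  Arms As p Bs = Chain (p ∷ As) × Chain (p ∷ Bs) × Uniq (p ∷ As ++ Bs)

  ∈-arms⁺ : ∀ {y} (As : List V) p Bs → y ∈ p ∷ As ++ Bs → y ∈ (As ʳ++ p ∷ Bs)
  ∈-arms⁺ As p Bs (here r) = ∈-ʳ++⁺ʳ As (p ∷ Bs) (here r)
  ∈-arms⁺ As p Bs (there q) with ∈-++⁻ As q
  ... | inj₁ r = ∈-ʳ++⁺ˡ As (p ∷ Bs) r
  ... | inj₂ r = ∈-ʳ++⁺ʳ As (p ∷ Bs) (there r)

  arms⇒Path : ∀ As p Bs → Arms As p Bs → Path (As ʳ++ p ∷ Bs)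
  arms⇒Path As p Bs (ca , cb , (p∉ , u)) with Uniq-++⁻ As Bs u
  ... | ua , ub , d = Chain-ʳ++ As Bs ca cb ,
      Uniq-ʳ++ As (p ∷ Bs) ua ((λ q → p∉ (∈-++⁺ʳ As q)) , ub)
        (λ { y yA (here refl) → p∉ (∈-++⁺ˡ yA) ; y yA (there q) → d y yA q })

  Path⇒arms : ∀ As p Bs → Path (As ʳ++ p ∷ Bs) → Arms As p Bs
  Path⇒arms As p Bs (c , u) with Chain-ʳ++⁻ As Bs c | Uniq-ʳ++⁻ As (p ∷ Bs) u
  ... | ca , cb | ua , (p∉ , ub) , d =
      ca , cb , ((λ q → [ (λ r → d p r (here refl)) , p∉ ]′ (∈-++⁻ As q)) ,
                Uniq-++ As Bs ua ub (λ y yA yB → d y yA (there yB)))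

  length-arms : ∀ (As : List V) p Bs → length (As ʳ++ p ∷ Bs) ≡ length As + suc (length Bs)
  length-arms As p Bs = LP.length-ʳ++ As {p ∷ Bs}

  Arms-swap : ∀ As p Bs → Arms As p Bs → Arms Bs p As
  Arms-swap As p Bs (ca , cb , (p∉ , u)) with Uniq-++⁻ As Bs u
  ... | ua , ub , d = cb , ca , ((λ q → p∉ ([ ∈-++⁺ʳ As , ∈-++⁺ˡ ]′ (∈-++⁻ Bs q))) ,
                                 Uniq-++ Bs As ub ua (Disjoint-sym As Bs d))

  Chain-reverse : ∀ x xs → Chain (x ∷ xs) → Chain (reverse (x ∷ xs))
  Chain-reverse x xs c = Chain-ʳ++ xs [] c tt

  Path-reverse : ∀ P → Path P → Path (reverse P)
  Path-reverse [] p = p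
  Path-reverse (x ∷ xs) (c , u) = Chain-reverse x xs c , Uniq-reverse (x ∷ xs) u

  -- Sufficiency of the conditions

  module Sufficiency (cact : IsCactus G) (c1 : Cond1 G) (c2 : Cond2 G) (c3 : Cond3 G) where

    EdgeBlock-isSimpleCycle : ∀ u0 v0 (e0 : A u0 v0) {x y z} → EdgeBlock.InBlock u0 v0 e0 x → EdgeBlock.InBlock u0 v0 e0 y → EdgeBlock.InBlock u0 v0 e0 z →
            x ≢ y → x ≢ z → y ≢ z → IsSimpleCycle (EdgeBlock.block u0 v0 e0)
    EdgeBlock-isSimpleCycle u0 v0 e0 px py pz nxy nxz nyz with proj₂ cact (EdgeBlock.block u0 v0 e0) (EdgeBlock.block-isBlock u0 v0 e0)
    ... | inj₁ se = ⊥-elim (SingleEdge.no-three-vertices (EdgeBlock.block u0 v0 e0) se px py pz nxy nxz nyz)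
    ... | inj₂ cy = cy

    MaximalArms : List V → V → List V → Set
    MaximalArms As p Bs = ∀ As' p' Bs' → Arms As' p' Bs' → length As + length Bs < length As' + length Bs' → ⊥

    -- p separates w from b while a, b are joined in G - p, so p, a, b lie on one
    -- cycle block in which p is an articulation vertex.
    module ArmsThroughCycle (a : V) (A1 : List V) (p b : V) (B1 : List V) (w : V)
              (arms : Arms (a ∷ A1) p (b ∷ B1)) (maximal : MaximalArms (a ∷ A1) p (b ∷ B1))
              (w∉ : w ∉ p ∷ (a ∷ A1) ++ (b ∷ B1)) (epw : A p w)
              (nwb : ¬ Reach (induced (avoid p)) w b) (rab : Reach (induced (avoid p)) a b) (nArtA : ¬ Art a) where
      As = a ∷ A1
      Bs = b ∷ B1
      ca = proj₁ arms
      cb = proj₁ (proj₂ arms)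
      p∉ = proj₁ (proj₂ (proj₂ arms))
      uAB = proj₂ (proj₂ (proj₂ arms))
      ua = proj₁ (Uniq-++⁻ As Bs uAB)
      dAB = proj₂ (proj₂ (Uniq-++⁻ As Bs uAB))
      e0 : A p b
      e0 = proj₁ cb
      epa : A p a
      epa = proj₁ ca
      open EdgeBlock p b e0
      a∈B : InBlock a
      a∈B = InBlock-extend InBlock-u0 epa (inj₂ rab)
      a≢b : a ≢ b
      a≢b q = dAB a (here refl) (subst (_∈ Bs) (esym q) (here refl))
      p≢a : p ≢ a
      p≢a q = p∉ (∈-++⁺ˡ {ys = Bs} (here q))
      p≢b : p ≢ b
      p≢b q = p∉ (∈-++⁺ʳ As (here q))
      w≢p : w ≢ p
      w≢p q = w∉ (here q)
      cy = EdgeBlock-isSimpleCycle p b e0 InBlock-u0 InBlock-v0 a∈B p≢b p≢a (λ q → a≢b (esym q))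
      open SimpleCycle block cy
      artp : Art p
      artp = Art-intro w≢p (λ q → p≢b (esym q)) nwb

      InBlock⇒¬Art : ∀ x → InBlock x → x ≢ p → x ≢ b → ¬ Art x
      InBlock⇒¬Art x sx xp xb with x ≟ a
      ... | yes refl = nArtA
      ... | no xa = λ ax → at-most-two-neighbours {p} (InBlock-u0 , a∈B , epa) (InBlock-u0 , InBlock-v0 , e0)
                         (InBlock-u0 , sx , Adj-sym (c3 block block-isBlock x p xp sx InBlock-u0 ax artp))
                         a≢b (λ q → xa (esym q)) (λ q → xb (esym q))

      arm⊆block : ∀ x L → Chain (x ∷ L) → InBlock x → ¬ Art x → (∀ y → y ∈ L → y ≢ p × y ≢ b) → ∀ y → y ∈ x ∷ L → InBlock y
      arm⊆block x L c sx nx f y (here refl) = sx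
      arm⊆block x (x' ∷ L) (e , c) sx nx f y (there q) =
        let sx' = InBlock-step nx sx e in
        arm⊆block x' L c sx' (InBlock⇒¬Art x' sx' (proj₁ (f x' (here refl))) (proj₂ (f x' (here refl)))) (λ y q → f y (there q)) y q

      As⊆block : ∀ y → y ∈ As → InBlock y
      As⊆block = arm⊆block a A1 (proj₂ ca) a∈B nArtA
               (λ y q → (λ r → p∉ (∈-++⁺ˡ {ys = Bs} (there (subst (_∈ A1) r q)))) ,
                        (λ r → dAB y (there q) (subst (_∈ Bs) (esym r) (here refl))))

      z : V
      z = lastOf a A1
      z∈ : z ∈ As
      z∈ = lastOf-∈ a A1
      z∈B : InBlock z
      z∈B = As⊆block z z∈
      z≢p : z ≢ p
      z≢p q = p∉ (∈-++⁺ˡ {ys = Bs} (subst (_∈ As) q z∈))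
      z≢b : z ≢ b
      z≢b q = dAB z z∈ (subst (_∈ Bs) (esym q) (here refl))
      nArtZ : ¬ Art z
      nArtZ = InBlock⇒¬Art z z∈B z≢p z≢b

      P : List V
      P = As ʳ++ p ∷ Bs
      pathP : Path P
      pathP = arms⇒Path As p Bs arms
      ub = proj₁ (proj₂ (Uniq-++⁻ As Bs uAB))

      hr = ʳ++-head a A1 (p ∷ Bs)
      eqP : P ≡ z ∷ proj₁ hr
      eqP = proj₂ hr

      p∈P : p ∈ P
      p∈P = ∈-arms⁺ As p Bs (here refl)

      ∈-reverse-arm : ∀ {x} → x ∈ As ++ reverse Bs → x ∈ As ++ Bs
      ∈-reverse-arm q = [ ∈-++⁺ˡ , (λ r → ∈-++⁺ʳ As (AnyP.reverse⁻ {xs = Bs} r)) ]′ (∈-++⁻ As q)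

      -- An edge from z to b, or to the last vertex of Bs, turns P into the longer path
      -- w p a … z b … or w p a … z … b.
      no-edge-to-b : A z b → ⊥
      no-edge-to-b ezb = maximal (w ∷ []) p (As ++ Bs)
        ((epw , tt) , Chain-++ {p} {b} As B1 ca ezb (proj₂ cb) ,
         ((λ { (here q) → w≢p (esym q) ; (there q) → p∉ q }) , (λ q → w∉ (there q)) , uAB))
        (subst (λ t → length As + length Bs < suc t) (esym (LP.length-++ As)) (ℕP.n<1+n (length As + length Bs)))

      no-edge-to-end : A z (lastOf b B1) → ⊥
      no-edge-to-end ezl = maximal (w ∷ []) p (As ++ reverse Bs)
        ((epw , tt) , chainR ,
         ((λ { (here q) → w≢p (esym q) ; (there q) → p∉ (∈-reverse-arm q) }) , (λ q → w∉ (there (∈-reverse-arm q))) ,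
          Uniq-++ As (reverse Bs) ua (Uniq-reverse Bs ub) (λ y yA yr → dAB y yA (AnyP.reverse⁻ {xs = Bs} yr))))
        (subst (λ t → length As + length Bs < suc t)
           (esym (trans (LP.length-++ As) (cong (length As +_) (LP.length-reverse Bs))))
           (ℕP.n<1+n (length As + length Bs)))
        where
          hb = ʳ++-head b B1 []
          chainR : Chain (p ∷ As ++ reverse Bs)
          chainR = subst (λ t → Chain (p ∷ As ++ t)) (esym (proj₂ hb))
                     (Chain-++ {p} {lastOf b B1} As (proj₁ hb) ca ezl
                        (subst Chain (proj₂ hb) (Chain-reverse b B1 (proj₂ cb))))

      no-edge-outside : ∀ y → y ∉ P → A z y → ⊥
      no-edge-outside y y∉ ezy = maximal (As ++ y ∷ []) p Bs
        (Chain-++ {p} {y} As [] ca ezy tt , cb , uq)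
        (subst (λ t → length As + length Bs < t + length Bs) (esym (LP.length-++ As))
           (ℕP.+-monoˡ-< (length Bs) (ℕP.m<m+n (length As) (s≤s z≤n))))
        where
          y∉U : y ∉ As ++ Bs
          y∉U q = y∉ (∈-arms⁺ As p Bs (there q))
          uq : Uniq (p ∷ (As ++ y ∷ []) ++ Bs)
          uq = subst (λ t → Uniq (p ∷ t)) (esym (LP.++-assoc As (y ∷ []) Bs))
                 ((λ q → [ (λ r → p∉ (∈-++⁺ˡ r)) ,
                           (λ { (here r) → y∉ (subst (_∈ P) r p∈P) ; (there r) → p∉ (∈-++⁺ʳ As r) }) ]′ (∈-++⁻ As q)) ,
                  Uniq-insert As Bs uAB y∉U)

      no-third-neighbour : ∀ zp T' → P ≡ z ∷ zp ∷ T' → A z zp → ∀ y → InBlock y → A z y → y ≢ zp → ⊥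
      no-third-neighbour zp T' e ezzp y y∈B ezy y≢zp with y ∈? P
      ... | no y∉ = no-edge-outside y y∉ ezy
      ... | yes yP with y ≟ p
      ...   | yes refl with z ≟ a
      ...     | yes za = y≢zp (esym (second-of-ʳ++ (lastOf-self a A1 (proj₁ ua) za) e))
        where
          second-of-ʳ++ : ∀ {xs u v T} → xs ≡ [] → (a ∷ xs) ʳ++ p ∷ Bs ≡ u ∷ v ∷ T → v ≡ p
          second-of-ʳ++ refl refl = refl
      ...     | no za = at-most-two-neighbours {p} (InBlock-u0 , a∈B , epa) (InBlock-u0 , InBlock-v0 , e0) (InBlock-u0 , z∈B , Adj-sym ezy)
                          a≢b (λ q → za (esym q)) (λ q → z≢b (esym q))
      no-third-neighbour zp T' e ezzp y y∈B ezy y≢zp | yes yP | no y≢p with y ≟ b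
      ...     | yes refl = no-edge-to-b ezy
      ...     | no y≢b = ∉-path (subst (y ∈_) e yP)
        where
          nArtY = InBlock⇒¬Art y y∈B y≢p y≢b
          pathZ : Path (z ∷ zp ∷ T')
          pathZ = subst Path e pathP
          ∉-path : y ∈ z ∷ zp ∷ T' → ⊥
          ∉-path (here q) = Adj⇒≢ ezy (esym q)
          ∉-path (there (here q)) = y≢zp q
          ∉-path (there (there q)) with ∈-∃++ q
          ... | Y1 , [] , refl =
                no-edge-to-end (subst (A z) (LP.∷ʳ-injectiveʳ (z ∷ zp ∷ Y1) (proj₁ lr) (trans (esym e) (proj₂ lr))) ezy)
            where lr = ʳ++-last As p Bs
          ... | Y1 , n2 ∷ Y3 , refl with Chain-++⁻ {zp} {y} Y1 (n2 ∷ Y3) (proj₂ (proj₁ pathZ))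
          ...   | _ , en1y , (eyn2 , _) =
                at-most-two-neighbours {y} (y∈B , z∈B , Adj-sym ezy) (y∈B , InBlock-step nArtY y∈B (Adj-sym en1y) , Adj-sym en1y)
                       (y∈B , InBlock-step nArtY y∈B eyn2 , eyn2)
                       (λ q → z∉ (subst (_∈ zp ∷ Y1 ++ y ∷ n2 ∷ Y3) (esym q) (∈-++⁺ˡ (lastOf-∈ zp Y1))))
                       (λ q → z∉ (subst (_∈ zp ∷ Y1 ++ y ∷ n2 ∷ Y3) (esym q) (∈-++⁺ʳ (zp ∷ Y1) (there (here refl)))))
                       (λ q → dj _ (lastOf-∈ zp Y1) (subst (_∈ y ∷ n2 ∷ Y3) (esym q) (there (here refl))))
            where
              z∉ = proj₁ (proj₂ pathZ)
              dj = proj₂ (proj₂ (Uniq-++⁻ (zp ∷ Y1) (y ∷ n2 ∷ Y3) (proj₂ (proj₂ pathZ))))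

      impossible : ⊥
      impossible = z-has-no-successor (proj₁ hr) eqP
        where
          z-has-no-successor : ∀ T → P ≡ z ∷ T → ⊥
          z-has-no-successor [] e with subst (p ∈_) e p∈P
          ... | here q = z≢p (esym q)
          z-has-no-successor (zp ∷ T') e =
            let pathZ = subst Path e pathP
                ezzp = proj₁ (proj₁ pathZ)
                zp∈B = InBlock-step nArtZ z∈B ezzp
                ex = other-neighbour {z} {zp} (z∈B , zp∈B , ezzp)
            in no-third-neighbour zp T' e ezzp (proj₁ ex) (proj₁ (proj₂ (proj₁ (proj₂ ex))))
                 (proj₂ (proj₂ (proj₁ (proj₂ ex)))) (proj₂ (proj₂ ex))

    ear : ∀ k m (U : List V) p x t → size m ≤ k → (∀ q → T (m q) → q ≢ p) → x ∉ U → t ∈ U → Reach (induced m) x t →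
          ∃ λ E1 → ∃ λ y → y ∈ U × y ≢ p × Chain (x ∷ E1) × A (lastOf x E1) y × Uniq (x ∷ E1) ×
                           (∀ q → q ∈ x ∷ E1 → q ∉ U) × (∀ q → q ∈ x ∷ E1 → T (m q))
    ear k m U p x t c f x∉ tU r with x ≟ t
    ... | yes refl = ⊥-elim (x∉ tU)
    ... | no x≢t with Reach-last-exit m x r x≢t | k
    ...   | y' , e , r' | zero = ⊥-elim (ℕP.n≮0 (ℕP.<-≤-trans (size-remove m x (Reach-source r)) c))
    ...   | y' , e , r' | suc k' with y' ∈? U
    ...     | yes yU = [] , y' , yU , f y' (remove⊆ x m y' (Reach-source r')) , tt , e , ((λ ()) , tt) ,
                       (λ { q (here refl) → x∉ }) , (λ { q (here refl) → Reach-source r })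
    ...     | no y∉ with ear k' (remove x m) U p y' t (ℕP.≤-pred (ℕP.<-≤-trans (size-remove m x (Reach-source r)) c))
                           (λ q mq → f q (remove⊆ x m q mq)) y∉ tU r'
    ...       | E1 , y , yU , yp , ch , ey , uq , nU , inm =
                y' ∷ E1 , y , yU , yp , (e , ch) , ey ,
                ((λ q → remove-≢ x m x (inm x q) refl) , uq) ,
                (λ { q (here refl) → x∉ ; q (there qq) → nU q qq }) ,
                (λ { q (here refl) → Reach-source r ; q (there qq) → remove⊆ x m q (inm q qq) })

    module EarToFirst (a : V) (A1 : List V) (p : V) (y : V) (B2 : List V) (w : V) (E1 : List V)
              (arms : Arms (a ∷ A1) p (y ∷ B2)) (maximal : MaximalArms (a ∷ A1) p (y ∷ B2))
              (epw : A p w) (cE : Chain (w ∷ E1)) (ewy : A (lastOf w E1) y) (uE : Uniq (w ∷ E1))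
              (eU : ∀ q → q ∈ w ∷ E1 → q ∉ p ∷ (a ∷ A1) ++ (y ∷ B2)) where
      As = a ∷ A1
      Bs = y ∷ B2
      E = w ∷ E1
      ca = proj₁ arms
      cb = proj₁ (proj₂ arms)
      p∉ = proj₁ (proj₂ (proj₂ arms))
      uAB = proj₂ (proj₂ (proj₂ arms))
      ua = proj₁ (Uniq-++⁻ As Bs uAB)
      ub = proj₁ (proj₂ (Uniq-++⁻ As Bs uAB))
      dAB = proj₂ (proj₂ (Uniq-++⁻ As Bs uAB))

      impossible : ⊥
      impossible = maximal As p (E ++ Bs)
        (ca , (epw , Chain-++ {w} {y} E1 B2 cE ewy (proj₂ cb)) ,
         ((λ q → [ (λ r → p∉ (∈-++⁺ˡ r)) ,
                   (λ r → [ (λ s → eU p s (here refl)) , (λ s → p∉ (∈-++⁺ʳ As s)) ]′ (∈-++⁻ E r)) ]′ (∈-++⁻ As q)) ,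
          Uniq-++ As (E ++ Bs) ua (Uniq-++ E Bs uE ub (λ q qE qB → eU q qE (there (∈-++⁺ʳ As qB))))
            (λ q qA qEB → [ (λ s → eU q s (there (∈-++⁺ˡ qA))) , (λ s → dAB q qA s) ]′ (∈-++⁻ E qEB))))
        (ℕP.+-monoʳ-< (length As) (subst (length Bs <_) (esym (LP.length-++ E {Bs}))
           (ℕP.m<n+m (length Bs) (s≤s z≤n))))

    -- The ear closes the cycle p w … y … b p. Neither a nor the successor of y on
    -- P lies on it, so p and y are articulation vertices of this cycle block and
    -- (3) would give p the third cycle neighbour y; if y ends P, P is rerouted
    -- around the cycle instead.
    module EarToLater (a : V) (A1 : List V) (p b : V) (B1 : List V) (y : V) (B2 : List V) (w : V) (E1 : List V)
              (arms : Arms (a ∷ A1) p (b ∷ B1 ++ y ∷ B2)) (maximal : MaximalArms (a ∷ A1) p (b ∷ B1 ++ y ∷ B2))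
              (epw : A p w) (cE : Chain (w ∷ E1)) (ewy : A (lastOf w E1) y) (uE : Uniq (w ∷ E1))
              (eU : ∀ q → q ∈ w ∷ E1 → q ∉ p ∷ (a ∷ A1) ++ (b ∷ B1 ++ y ∷ B2)) where
      As = a ∷ A1
      Bp = b ∷ B1
      Bs = Bp ++ y ∷ B2
      U = p ∷ As ++ Bs
      ca = proj₁ arms
      cb = proj₁ (proj₂ arms)
      p∉ = proj₁ (proj₂ (proj₂ arms))
      uAB = proj₂ (proj₂ (proj₂ arms))
      ua = proj₁ (Uniq-++⁻ As Bs uAB)
      ub = proj₁ (proj₂ (Uniq-++⁻ As Bs uAB))
      dAB = proj₂ (proj₂ (Uniq-++⁻ As Bs uAB))
      E = w ∷ E1
      w∉ : w ∉ U
      w∉ = eU w (here refl)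
      inBs : ∀ {q} → q ∈ Bs → q ∈ U
      inBs q = there (∈-++⁺ʳ As q)
      inAs : ∀ {q} → q ∈ As → q ∈ U
      inAs q = there (∈-++⁺ˡ q)
      uEB : ∀ L → Uniq L → (∀ q → q ∈ L → q ∈ Bs) → Uniq (E ++ L)
      uEB L uL sub = Uniq-++ E L uE uL (λ q qE qL → eU q qE (inBs (sub q qL)))

      RB = reverse Bp
      rest = E1 ++ y ∷ RB
      splitB = Uniq-++⁻ Bp (y ∷ B2) ub
      y∉Bp : y ∉ Bp
      y∉Bp q = proj₂ (proj₂ splitB) y q (here refl)
      inRB : ∀ {q} → q ∈ y ∷ RB → q ∈ Bs
      inRB (here r) = ∈-++⁺ʳ Bp (here r)
      inRB (there r) = ∈-++⁺ˡ (AnyP.reverse⁻ {xs = Bp} r)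
      cbs = Chain-++⁻ {b} {y} B1 B2 (proj₂ cb)
      eby : A (lastOf b B1) y
      eby = proj₁ (proj₂ cbs)
      chainYRB : Chain (y ∷ RB)
      chainYRB = subst Chain (LP.++-ʳ++ Bp {y ∷ []} {[]}) (Chain-reverse b (B1 ++ y ∷ []) (Chain-++ {b} {y} B1 [] (proj₁ cbs) eby tt))
      chainWrest : Chain (w ∷ rest)
      chainWrest = Chain-++ {w} {y} E1 RB cE ewy chainYRB
      uYRB : Uniq (y ∷ RB)
      uYRB = (λ q → y∉Bp (AnyP.reverse⁻ {xs = Bp} q)) , Uniq-reverse Bp (proj₁ splitB)
      uRest : Uniq (w ∷ rest)
      uRest = uEB (y ∷ RB) uYRB (λ _ → inRB)
      p∉wrest : p ∉ w ∷ rest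
      p∉wrest q = [ (λ s → eU p s (here refl)) , (λ r → p∉ (∈-++⁺ʳ As (inRB r))) ]′ (∈-++⁻ E q)
      lastRest : lastOf w rest ≡ b
      lastRest = trans (lastOf-++ w E1 y RB)
                   (trans (cong (lastOf y) (proj₂ (ʳ++-last B1 b []))) (lastOf-++ y (proj₁ (ʳ++-last B1 b [])) b []))
      ebp : A (lastOf w rest) p
      ebp = subst (λ t → A t p) (esym lastRest) (Adj-sym (proj₁ cb))
      open EdgeBlock p w epw
      rest⊆B : ∀ q → q ∈ rest → InBlock q
      rest⊆B = cycle⊆InBlock rest chainWrest (p∉wrest , uRest) ebp
      b∈B : InBlock b
      b∈B = rest⊆B b (∈-++⁺ʳ E1 (there (AnyP.reverse⁺ {xs = Bp} (here refl))))
      y∈B : InBlock y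
      y∈B = rest⊆B y (∈-++⁺ʳ E1 (here refl))
      lb = lastOf b B1
      lb∈B : InBlock lb
      lb∈B = rest⊆B lb (∈-++⁺ʳ E1 (there (AnyP.reverse⁺ {xs = Bp} (lastOf-∈ b B1))))
      lw = lastOf w E1
      lw∈B : InBlock lw
      lw∈B with lastOf-∈ w E1
      ... | here q = subst InBlock (esym q) InBlock-v0
      ... | there q = rest⊆B lw (∈-++⁺ˡ q)
      p≢w : p ≢ w
      p≢w q = w∉ (subst (_∈ U) q (here refl))
      p≢b : p ≢ b
      p≢b q = p∉ (∈-++⁺ʳ As (subst (_∈ Bs) (esym q) (here refl)))
      p≢y : p ≢ y
      p≢y q = p∉ (∈-++⁺ʳ As (subst (_∈ Bs) (esym q) (∈-++⁺ʳ Bp (here refl))))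
      w≢b : w ≢ b
      w≢b q = w∉ (inBs (subst (_∈ Bs) (esym q) (here refl)))
      w≢y : w ≢ y
      w≢y q = w∉ (inBs (subst (_∈ Bs) (esym q) (∈-++⁺ʳ Bp (here refl))))
      w≢a : w ≢ a
      w≢a q = w∉ (inAs (subst (_∈ As) (esym q) (here refl)))
      b≢y : b ≢ y
      b≢y q = y∉Bp (subst (_∈ Bp) q (here refl))
      b≢a : b ≢ a
      b≢a q = dAB a (here refl) (subst (_∈ Bs) q (here refl))
      cy = EdgeBlock-isSimpleCycle p w epw InBlock-u0 InBlock-v0 b∈B p≢w p≢b w≢b
      open SimpleCycle block cy
      a∉B : ¬ InBlock a
      a∉B a∈B = at-most-two-neighbours {p} (InBlock-u0 , InBlock-v0 , epw) (InBlock-u0 , b∈B , proj₁ cb) (InBlock-u0 , a∈B , proj₁ ca) w≢b w≢a b≢a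
      nnArtP : ¬ ¬ Art p
      nnArtP na = a∉B (InBlock-step na InBlock-u0 (proj₁ ca))
      lw∉ : lw ∉ U
      lw∉ = eU lw (lastOf-∈ w E1)

      continues-past-y : ∀ s B3 → B2 ≡ s ∷ B3 → ⊥
      continues-past-y s B3 refl = nnArtP (λ ap → nnArtY (λ ay →
          at-most-two-neighbours {p} (InBlock-u0 , InBlock-v0 , epw) (InBlock-u0 , b∈B , proj₁ cb)
             (InBlock-u0 , y∈B , c3 block block-isBlock p y p≢y InBlock-u0 y∈B ap ay)
             w≢b w≢y b≢y))
        where
          eys : A y s
          eys = proj₁ (proj₂ (proj₂ cbs))
          lb≢s : lb ≢ s
          lb≢s q = proj₂ (proj₂ splitB) lb (lastOf-∈ b B1) (subst (_∈ y ∷ s ∷ B3) (esym q) (there (here refl)))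
          s∉B : ¬ InBlock s
          s∉B s∈B = at-most-two-neighbours {y} (y∈B , lw∈B , Adj-sym ewy) (y∈B , lb∈B , Adj-sym eby) (y∈B , s∈B , eys)
                      (λ q → lw∉ (inBs (subst (_∈ Bs) (esym q) (∈-++⁺ˡ (lastOf-∈ b B1)))))
                      (λ q → lw∉ (inBs (subst (_∈ Bs) (esym q) (∈-++⁺ʳ Bp (there (here refl))))))
                      lb≢s
          nnArtY : ¬ ¬ Art y
          nnArtY na = s∉B (InBlock-step na y∈B eys)

      ends-at-y : B2 ≡ [] → ⊥
      ends-at-y refl = maximal As p (w ∷ rest)
        (ca , (epw , chainWrest) ,
         ((λ q → [ (λ r → p∉ (∈-++⁺ˡ r)) , p∉wrest ]′ (∈-++⁻ As q)) ,
          Uniq-++ As (w ∷ rest) ua uRest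
            (λ q qA qR → [ (λ s → eU q s (inAs qA)) , (λ r → dAB q qA (inRB r)) ]′ (∈-++⁻ E qR))))
        (ℕP.+-monoʳ-< (length As) lt)
        where
          eqL : length Bs ≡ length (y ∷ RB)
          eqL = trans (esym (LP.length-reverse Bs)) (cong length (LP.++-ʳ++ Bp {y ∷ []} {[]}))
          lt : length Bs < length (w ∷ rest)
          lt = subst₂ _<_ (esym eqL) (esym (cong suc (LP.length-++ E1 {y ∷ RB})))
                 (s≤s (ℕP.m≤n+m (length (y ∷ RB)) (length E1)))

      impossible : ⊥
      impossible = cases B2 refl
        where cases : ∀ L → B2 ≡ L → ⊥
              cases [] e = ends-at-y e
              cases (s ∷ B3) e = continues-past-y s B3 e

    MaximalArms-swap : ∀ As p Bs → MaximalArms As p Bs → MaximalArms Bs p As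
    MaximalArms-swap As p Bs maximal A' p' B' arms lt = maximal A' p' B' arms (subst (_< length A' + length B') (ℕP.+-comm (length Bs) (length As)) lt)

    ∈-arms-swap : ∀ {q} (As : List V) p Bs → q ∈ p ∷ As ++ Bs → q ∈ p ∷ Bs ++ As
    ∈-arms-swap As p Bs (here r) = here r
    ∈-arms-swap As p Bs (there q) = there ([ ∈-++⁺ʳ _ , ∈-++⁺ˡ ]′ (∈-++⁻ As q))

    ear-into-arm : ∀ a A1 p b B1 w E1 y → Arms (a ∷ A1) p (b ∷ B1) → MaximalArms (a ∷ A1) p (b ∷ B1) →
           A p w → Chain (w ∷ E1) → A (lastOf w E1) y → Uniq (w ∷ E1) →
           (∀ q → q ∈ w ∷ E1 → q ∉ p ∷ (a ∷ A1) ++ (b ∷ B1)) → y ∈ b ∷ B1 → ⊥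
    ear-into-arm a A1 p b B1 w E1 y arms maximal epw cE ewy uE eU yB with ∈-∃++ yB
    ... | [] , B2 , refl = EarToFirst.impossible a A1 p y B2 w E1 arms maximal epw cE ewy uE eU
    ... | b' ∷ B1' , B2 , refl = EarToLater.impossible a A1 p b' B1' y B2 w E1 arms maximal epw cE ewy uE eU

    no-outside-neighbour : ∀ a A1 p b B1 w → Arms (a ∷ A1) p (b ∷ B1) → MaximalArms (a ∷ A1) p (b ∷ B1) →
               w ∉ p ∷ (a ∷ A1) ++ (b ∷ B1) → A p w → ⊥
    no-outside-neighbour a A1 p b B1 w arms maximal w∉ epw
      with Any.any? (λ t → reach? (avoid p) w t) ((a ∷ A1) ++ (b ∷ B1))
    ... | yes anyT with find anyT
    ...   | t , tin , r with ear (size (avoid p)) (avoid p) (p ∷ (a ∷ A1) ++ (b ∷ B1)) p w t ℕP.≤-refl (avoid⁻ p) w∉ (there tin) r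
    ...     | E1 , y , here y≡p , y≢p , _ = y≢p y≡p
    ...     | E1 , y , there yAB , y≢p , cE , ewy , uE , eU , _ with ∈-++⁻ (a ∷ A1) yAB
    ...       | inj₂ yB = ear-into-arm a A1 p b B1 w E1 y arms maximal epw cE ewy uE eU yB
    ...       | inj₁ yA = ear-into-arm b B1 p a A1 w E1 y (Arms-swap (a ∷ A1) p (b ∷ B1) arms) (MaximalArms-swap (a ∷ A1) p (b ∷ B1) maximal)
                   epw cE ewy uE (λ q qE qU → eU q qE (∈-arms-swap (b ∷ B1) p (a ∷ A1) qU)) yA
    no-outside-neighbour a A1 p b B1 w arms maximal w∉ epw | no nany = impossible
      where
        As : List V
        As = a ∷ A1
        Bs : List V
        Bs = b ∷ B1
        p∉ = proj₁ (proj₂ (proj₂ arms))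
        dAB = proj₂ (proj₂ (Uniq-++⁻ As Bs (proj₂ (proj₂ (proj₂ arms)))))
        nwa : ¬ Reach (induced (avoid p)) w a
        nwa r = nany (lose (here refl) r)
        nwb : ¬ Reach (induced (avoid p)) w b
        nwb r = nany (lose (∈-++⁺ʳ As (here refl)) r)
        w≢p : w ≢ p
        w≢p q = w∉ (here q)
        a≢p : a ≢ p
        a≢p q = p∉ (∈-++⁺ˡ {ys = Bs} (here (esym q)))
        b≢p : b ≢ p
        b≢p q = p∉ (∈-++⁺ʳ As (here (esym q)))
        a≢b : a ≢ b
        a≢b q = dAB a (here refl) (here q)
        e0 : A p b
        e0 = proj₁ (proj₁ (proj₂ arms))
        impossible : ⊥
        impossible with reach? (avoid p) a b
        ... | no nab with three-components p w≢p a≢p b≢p nwa nwb nab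
        ...   | k , nc , k≥3 = ℕP.<-irrefl refl (ℕP.<-≤-trans (ℕP.≤-trans (s≤s (c1 p k nc)) k≥3) ℕP.≤-refl)
        impossible | yes rab = ArmsThroughCycle.impossible a A1 p b B1 w arms maximal w∉ epw nwb rab nArtA
          where
            open EdgeBlock p b e0
            a∈B : InBlock a
            a∈B = InBlock-extend InBlock-u0 (proj₁ (proj₁ arms)) (inj₂ rab)
            artp : Art p
            artp = Art-intro w≢p b≢p nwb
            nArtA : ¬ Art a
            nArtA artA = ArmsThroughCycle.impossible b B1 p a A1 w (Arms-swap As p Bs arms) (MaximalArms-swap As p Bs maximal)
                           (λ q → w∉ (∈-arms-swap Bs p As q)) epw nwa (Reach-sym rab) nArtB
              where
                nArtB : ¬ Art b
                nArtB artB = c2 block block-isBlock (p , a , b , (λ q → a≢p (esym q)) , (λ q → b≢p (esym q)) , a≢b ,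
                                           InBlock-u0 , a∈B , InBlock-v0 , artp , artA , artB)

    Longest : List V → Set
    Longest P = ∀ Q → Path Q → length P < length Q → ⊥

    Longest⇒MaximalArms : ∀ As p Bs → Longest (As ʳ++ p ∷ Bs) → MaximalArms As p Bs
    Longest⇒MaximalArms As p Bs longest A' p' B' arms lt = longest (A' ʳ++ p' ∷ B') (arms⇒Path A' p' B' arms)
       (subst₂ _<_ (esym (length-arms As p Bs)) (esym (length-arms A' p' B'))
          (subst₂ _<_ (esym (ℕP.+-suc (length As) (length Bs))) (esym (ℕP.+-suc (length A') (length B'))) (s≤s lt)))

    leaving-edge : ∀ (P : List V) {x v} → Reach (whole {G}) x v → x ∈ P → v ∉ P → ∃ λ u → ∃ λ w → u ∈ P × w ∉ P × A u w
    leaving-edge P (here _) xP v∉ = ⊥-elim (v∉ xP)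
    leaving-edge P (step {x} {x'} e r) xP v∉ with x' ∈? P
    ... | yes x'P = leaving-edge P r x'P v∉
    ... | no x'∉ = x , x' , xP , x'∉ , e

    no-leaving-edge : ∀ L u R w → Path (L ++ u ∷ R) → Longest (L ++ u ∷ R) → w ∉ L ++ u ∷ R → A u w → ⊥
    no-leaving-edge [] u R w (ch , uq) longest w∉ e = longest (w ∷ u ∷ R) ((Adj-sym e , ch) , (w∉ , uq)) ℕP.≤-refl
    no-leaving-edge (l ∷ L') u [] w (ch , uq) longest w∉ e =
      longest ((l ∷ L') ++ u ∷ w ∷ [])
         (Chain-++ {l} {u} L' (w ∷ []) (proj₁ cs) (proj₁ (proj₂ cs)) (e , tt) ,
          subst Uniq (LP.++-assoc (l ∷ L') (u ∷ []) (w ∷ []))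
            (Uniq-insert ((l ∷ L') ++ u ∷ []) [] (subst Uniq (esym (LP.++-identityʳ _)) uq)
               (λ q → w∉ (subst (w ∈_) (LP.++-identityʳ _) q))))
         (subst₂ _<_ (esym (LP.length-++ (l ∷ L') {u ∷ []})) (esym (LP.length-++ (l ∷ L') {u ∷ w ∷ []}))
            (ℕP.+-monoʳ-< (length (l ∷ L')) ℕP.≤-refl))
      where cs = Chain-++⁻ {l} {u} L' [] ch
    no-leaving-edge (l ∷ L') u (r ∷ R') w pp longest w∉ e =
      no-outside-neighbour (lastOf l L') (proj₁ hL) u r R' w (Path⇒arms As u (r ∷ R') (proj₁ tr))
               (Longest⇒MaximalArms As u (r ∷ R') (proj₁ (proj₂ tr)))
               (λ q → proj₂ (proj₂ tr) (∈-arms⁺ As u (r ∷ R') q)) e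
      where
        hL = ʳ++-head l L' []
        As : List V
        As = lastOf l L' ∷ proj₁ hL
        eqP : (l ∷ L') ++ u ∷ r ∷ R' ≡ (lastOf l L' ∷ proj₁ hL) ʳ++ u ∷ r ∷ R'
        eqP = trans (esym (LP.ʳ++-ʳ++ (l ∷ L') {[]} {u ∷ r ∷ R'})) (cong (_ʳ++ u ∷ r ∷ R') (proj₂ hL))
        tr = subst (λ Q → Path Q × Longest Q × w ∉ Q) eqP (pp , longest , w∉)

    longest-spans : ∀ P → Path P → Longest P → ∀ v → v ∉ P → ∀ x0 → x0 ∈ P → ⊥
    longest-spans P pp longest v v∉ x0 x0P with leaving-edge P (proj₂ (proj₁ cact) x0 v tt tt) x0P v∉
    ... | u , w , uP , w∉ , e with ∈-∃++ uP
    ... | L , R , refl = no-leaving-edge L u R w pp longest w∉ e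

    grow-longest : ∀ k P → Path P → (∃ λ x → x ∈ P) → n G < k + length P → ∃ λ P → Path P × (∀ v → v ∈ P)
    grow-longest zero P pp _ lt = ⊥-elim (ℕP.<-irrefl refl (ℕP.<-≤-trans lt (Uniq-length≤ P (proj₂ pp))))
    grow-longest (suc k) P pp (x0 , x0P) lt with exists-list-of-length? (suc (length P)) Path Path?
    ... | yes (x ∷ Q , e , pq) = grow-longest k (x ∷ Q) pq (x , here refl)
            (subst (n G <_) (trans (esym (ℕP.+-suc k (length P))) (cong (k +_) (esym e))) lt)
    ... | no nq with all? (λ v → v ∈? P)
    ...   | yes allin = P , pp , allin
    ...   | no nall = ⊥-elim (longest-spans P pp longest v (proj₂ (FP.¬∀⟶∃¬ (n G) (λ v → v ∈ P) (λ v → v ∈? P) nall)) x0 x0P)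
      where
        v = proj₁ (FP.¬∀⟶∃¬ (n G) (λ v → v ∈ P) (λ v → v ∈? P) nall)
        longest : Longest P
        longest Q (ch , uq) lt with split-at (suc (length P)) Q lt
        ... | Q1 , Q2 , refl , e = nq (Q1 , e , Chain-prefix Q1 Q2 ch , proj₁ (Uniq-++⁻ Q1 Q2 uq))

    traceable : Traceable G
    traceable with proj₁ (proj₁ cact)
    ... | v0 , _ with grow-longest (suc (n G)) (v0 ∷ []) (tt , ((λ ()) , tt)) (v0 , here refl)
                         (s≤s (ℕP.m≤m+n (n G) 1))
    ...   | P , pp , allin = SpanningPath⇒Traceable P pp allin

  -- Necessity of the conditions

  block-minus-connected : ∀ (B : Subgraph G) → IsBlock B → ∀ x y y' → inV B x → inV B y → inV B y' → y ≢ x → y' ≢ x →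
            ¬ ¬ Reach (induced (avoid x)) y y'
  block-minus-connected B bl x y y' bx by by' yx y'x nr =
    proj₁ (proj₂ bl) x (bx , y , y' , (by , yx) , (by' , y'x) , (λ r → nr (Reach⇒avoid (λ q p → proj₂ p) r)))

  module Necessity (P : List V) (pathP : Path P) (cover : ∀ v → v ∈ P) where

    sideOf : ∀ L x R → P ≡ L ++ x ∷ R → ∀ y → y ≢ x → y ∈ L ⊎ y ∈ R
    sideOf L x R eq y yx with ∈-++⁻ L (subst (y ∈_) eq (cover y))
    ... | inj₁ q = inj₁ q
    ... | inj₂ (here e) = ⊥-elim (yx e)
    ... | inj₂ (there q) = inj₂ q

    sides-connected : ∀ L x R → P ≡ L ++ x ∷ R →
      (∀ u u' → u ∈ L → u' ∈ L → Reach (induced (avoid x)) u u') ×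
      (∀ u u' → u ∈ R → u' ∈ R → Reach (induced (avoid x)) u u')
    sides-connected L x R eq = Chain-connected (avoid x) L cL fL , Chain-connected (avoid x) R cR fR
      where
        path = subst Path eq pathP
        x∉ = Uniq-++-middle L x R (proj₂ path)
        cL : Chain L
        cL = Chain-prefix L (x ∷ R) (proj₁ path)
        cR : Chain R
        cR = Chain-tail R (Chain-suffix L (x ∷ R) (proj₁ path))
        fL : ∀ q → q ∈ L → T (avoid x q)
        fL q qL = avoid⁺ x q (λ e → proj₁ x∉ (subst (_∈ L) e qL))
        fR : ∀ q → q ∈ R → T (avoid x q)
        fR q qR = avoid⁺ x q (λ e → proj₂ x∉ (subst (_∈ R) e qR))

    Art-separates : ∀ L x R → P ≡ L ++ x ∷ R → Art x → ∀ u w → u ∈ L → w ∈ R → ¬ Reach (induced (avoid x)) u w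
    Art-separates L x R eq (_ , u0 , w0 , (_ , u0x) , (_ , w0x) , nr) u w uL wR ruw =
      nr (avoid⇒deleted (Reach-trans (toU u0 u0x) (Reach-sym (toU w0 w0x))))
      where
        toU : ∀ y → y ≢ x → Reach (induced (avoid x)) y u
        toU y yx with sideOf L x R eq y yx
        ... | inj₁ yL = proj₁ (sides-connected L x R eq) y u yL uL
        ... | inj₂ yR = Reach-trans (proj₂ (sides-connected L x R eq) y w yR wR) (Reach-sym ruw)

    cond1 : Cond1 G
    cond1 v k (r , r≢v , sep , _) with ∈-∃++ (cover v)
    ... | L , R , eq = FP.injective⇒≤ {f = side} (λ {i} {j} e → side-injective i j e)
      where
        side : Fin k → Fin 2
        side i with sideOf L v R eq (r i) (proj₂ (r≢v i))
        ... | inj₁ _ = fz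
        ... | inj₂ _ = fs fz
        side-injective : ∀ i j → side i ≡ side j → i ≡ j
        side-injective i j e with sideOf L v R eq (r i) (proj₂ (r≢v i)) | sideOf L v R eq (r j) (proj₂ (r≢v j))
        ... | inj₁ p | inj₁ q = sep i j (avoid⇒deleted (proj₁ (sides-connected L v R eq) _ _ p q))
        ... | inj₂ p | inj₂ q = sep i j (avoid⇒deleted (proj₂ (sides-connected L v R eq) _ _ p q))
        side-injective i j () | inj₁ p | inj₂ q
        side-injective i j () | inj₂ p | inj₁ q

    opposite-sides : ∀ (B : Subgraph G) → IsBlock B → ∀ L x R → P ≡ L ++ x ∷ R → Art x → inV B x →
          ∀ y z → inV B y → inV B z → y ≢ x → z ≢ x → y ∈ L → z ∈ R → ⊥
    opposite-sides B bl L x R eq ax bx y z by bz yx zx yL zR = block-minus-connected B bl x y z bx by bz yx zx (Art-separates L x R eq ax y z yL zR)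

    ++-∷-assoc : ∀ {x y : V} (X Y Z : List V) → (X ++ x ∷ (Y ++ y ∷ Z)) ≡ (X ++ x ∷ Y) ++ y ∷ Z
    ++-∷-assoc X Y Z = esym (LP.++-assoc X (_ ∷ Y) (_ ∷ Z))

    cond2 : Cond2 G
    cond2 B bl (a , b , c , ab , ac , bc , a∈B , b∈B , c∈B , art-a , art-b , art-c) with ∈-∃++ (cover a)
    ... | La , Ra , eqa with sideOf La a Ra eqa b (λ e → ab (esym e)) | sideOf La a Ra eqa c (λ e → ac (esym e))
    ...   | inj₁ bL | inj₂ cR = opposite-sides B bl La a Ra eqa art-a a∈B b c b∈B c∈B (λ e → ab (esym e)) (λ e → ac (esym e)) bL cR
    ...   | inj₂ bR | inj₁ cL = opposite-sides B bl La a Ra eqa art-a a∈B c b c∈B b∈B (λ e → ac (esym e)) (λ e → ab (esym e)) cL bR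
    ...   | inj₂ bR | inj₂ cR with ∈-∃++ bR
    ...     | R1 , R2 , refl with ∈-++⁻ R1 cR
    ...       | inj₂ (here e) = bc (esym e)
    ...       | inj₂ (there cR2) =
                opposite-sides B bl (La ++ a ∷ R1) b R2 (trans eqa (++-∷-assoc {a} {b} La R1 R2)) art-b b∈B a c a∈B c∈B ab (λ e → bc (esym e))
                    (∈-++⁺ʳ La (here refl)) cR2
    ...       | inj₁ cR1 with ∈-∃++ cR1
    ...         | S1 , S2 , refl =
                opposite-sides B bl (La ++ a ∷ S1) c (S2 ++ b ∷ R2)
                    (trans eqa (trans (cong (λ t → La ++ a ∷ t) (LP.++-assoc S1 (c ∷ S2) (b ∷ R2))) (++-∷-assoc {a} {c} La S1 (S2 ++ b ∷ R2))))
                    art-c c∈B a b a∈B b∈B ac bc (∈-++⁺ʳ La (here refl)) (∈-++⁺ʳ S2 (here refl))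
    cond2 B bl (a , b , c , ab , ac , bc , a∈B , b∈B , c∈B , art-a , art-b , art-c) | La , Ra , eqa | inj₁ bL | inj₁ cL with ∈-∃++ bL
    ...     | L1 , L2 , refl with ∈-++⁻ L1 cL
    ...       | inj₂ (here e) = bc (esym e)
    ...       | inj₁ cL1 =
                opposite-sides B bl L1 b (L2 ++ a ∷ Ra) (trans eqa (LP.++-assoc L1 (b ∷ L2) (a ∷ Ra))) art-b b∈B c a c∈B a∈B
                    (λ e → bc (esym e)) ab cL1 (∈-++⁺ʳ L2 (here refl))
    ...       | inj₂ (there cL2) with ∈-∃++ cL2
    ...         | T1 , T2 , refl =
                opposite-sides B bl (L1 ++ b ∷ T1) c (T2 ++ a ∷ Ra)
                    (trans eqa (trans (LP.++-assoc L1 (b ∷ T1 ++ c ∷ T2) (a ∷ Ra))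
                      (trans (cong (λ t → L1 ++ b ∷ t) (LP.++-assoc T1 (c ∷ T2) (a ∷ Ra))) (++-∷-assoc {b} {c} L1 T1 (T2 ++ a ∷ Ra)))))
                    art-c c∈B b a b∈B a∈B bc ac (∈-++⁺ʳ L1 (here refl)) (∈-++⁺ʳ T2 (here refl))

    module NonAdjacentArticulations (B : Subgraph G) (bl : IsBlock B) (cy : IsSimpleCycle B) (a b : V) (a≢b : a ≢ b)
                 (a∈B : inV B a) (b∈B : inV B b) (art-a : Art a) (art-b : Art b) (na : ¬ A a b)
                 (L R1 R2 : List V) (eq : P ≡ L ++ a ∷ (R1 ++ b ∷ R2)) where
      open SimpleCycle B cy
      eqb : P ≡ (L ++ a ∷ R1) ++ b ∷ R2
      eqb = trans eq (++-∷-assoc {a} {b} L R1 R2)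
      Z : List V
      Z = a ∷ R1 ++ b ∷ []
      eqZR : Z ++ R2 ≡ a ∷ R1 ++ b ∷ R2
      eqZR = cong (a ∷_) (LP.++-assoc R1 (b ∷ []) R2)
      pAR : Path (a ∷ R1 ++ b ∷ R2)
      pAR = Chain-suffix L _ (proj₁ (subst Path eq pathP)) , proj₁ (proj₂ (Uniq-++⁻ L _ (proj₂ (subst Path eq pathP))))
      chZ : Chain Z
      chZ = Chain-prefix Z R2 (subst Chain (esym eqZR) (proj₁ pAR))
      uZ : Uniq Z
      uZ = proj₁ (Uniq-++⁻ Z R2 (subst Uniq (esym eqZR) (proj₂ pAR)))
      b≢a : b ≢ a
      b≢a e = a≢b (esym e)

      BinZ : ∀ y → inV B y → y ∈ Z
      BinZ y y∈B with y ≟ a | y ≟ b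
      ... | yes refl | _ = here refl
      ... | no _ | yes refl = there (∈-++⁺ʳ R1 (here refl))
      ... | no ya | no yb with sideOf L a (R1 ++ b ∷ R2) eq y ya
      ...   | inj₁ yL = ⊥-elim (opposite-sides B bl L a (R1 ++ b ∷ R2) eq art-a a∈B y b y∈B b∈B ya b≢a yL (∈-++⁺ʳ R1 (here refl)))
      ...   | inj₂ yR with ∈-++⁻ R1 yR
      ...     | inj₁ yR1 = there (∈-++⁺ˡ yR1)
      ...     | inj₂ (here e) = ⊥-elim (yb e)
      ...     | inj₂ (there yR2) = ⊥-elim (opposite-sides B bl (L ++ a ∷ R1) b R2 eqb art-b b∈B a y a∈B y∈B a≢b yb (∈-++⁺ʳ L (here refl)) yR2)

      H : Subgraph G
      H = record
        { inV = λ y → y ∈ Z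
        ; inE = λ u w → inE B u w ⊎ (Consecutive Z u w ⊎ Consecutive Z w u)
        ; inE-sym = λ { (inj₁ e) → inj₁ (inE-sym B e) ; (inj₂ (inj₁ z)) → inj₂ (inj₂ z) ; (inj₂ (inj₂ z)) → inj₂ (inj₁ z) }
        ; inE-adj = λ { (inj₁ e) → inE-adj B e ; (inj₂ (inj₁ z)) → Consecutive-Adj Z chZ z ; (inj₂ (inj₂ z)) → Adj-sym (Consecutive-Adj Z chZ z) }
        ; inE-V = λ { {u} {w} (inj₁ e) → BinZ u (proj₁ (inE-V B e)) , BinZ w (proj₂ (inE-V B e))
                    ; (inj₂ (inj₁ z)) → Consecutive-∈ Z z ; (inj₂ (inj₂ z)) → (proj₂ (Consecutive-∈ Z z) , proj₁ (Consecutive-∈ Z z)) }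
        }

      B⊆H : B ⊆ᴳ H
      B⊆H = BinZ , (λ u w e → inj₁ e)

      connH : Connected H
      connH = (a , here refl) , Consecutive-connected H Z (λ u w z → inj₂ (inj₁ z)) (λ s p → p)

      noArtH : NoArticulation H
      noArtH v (vZ , y , y' , (yZ , yv) , (y'Z , y'v) , nr) with ∈-∃++ vZ
      ... | Z1 , Z2 , eqZ = fin (side y yZ yv) (side y' y'Z y'v)
        where
          K = H -ᵛ v
          mid = Uniq-++-middle Z1 v Z2 (subst Uniq eqZ uZ)
          toZ1 : ∀ {s} → s ∈ Z1 → s ∈ Z
          toZ1 p = subst (_ ∈_) (esym eqZ) (∈-++⁺ˡ p)
          toZ2 : ∀ {s} → s ∈ Z2 → s ∈ Z
          toZ2 p = subst (_ ∈_) (esym eqZ) (∈-++⁺ʳ Z1 (there p))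
          ne1 : ∀ {s} → s ∈ Z1 → s ≢ v
          ne1 p e = proj₁ mid (subst (_∈ Z1) e p)
          ne2 : ∀ {s} → s ∈ Z2 → s ≢ v
          ne2 p e = proj₂ mid (subst (_∈ Z2) e p)
          reach1 : ∀ u u' → u ∈ Z1 → u' ∈ Z1 → Reach K u u'
          reach1 = Consecutive-connected K Z1
            (λ u w z → inj₂ (inj₁ (subst (λ t → Consecutive t u w) (esym eqZ) (Consecutive-++ʳ Z1 (v ∷ Z2) z))) ,
                       ne1 (proj₁ (Consecutive-∈ Z1 z)) , ne1 (proj₂ (Consecutive-∈ Z1 z)))
            (λ s p → toZ1 p , ne1 p)
          reach2 : ∀ u u' → u ∈ Z2 → u' ∈ Z2 → Reach K u u'
          reach2 = Consecutive-connected K Z2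
            (λ u w z → inj₂ (inj₁ (subst (λ t → Consecutive t u w) (esym eqZ) (Consecutive-++ˡ Z1 (v ∷ Z2) (Consecutive-∷ v Z2 z)))) ,
                       ne2 (proj₁ (Consecutive-∈ Z2 z)) , ne2 (proj₂ (Consecutive-∈ Z2 z)))
            (λ s p → toZ2 p , ne2 p)
          side : ∀ t → t ∈ Z → t ≢ v → t ∈ Z1 ⊎ t ∈ Z2
          side t tZ tv with ∈-++⁻ Z1 (subst (t ∈_) eqZ tZ)
          ... | inj₁ q = inj₁ q
          ... | inj₂ (here e) = ⊥-elim (tv e)
          ... | inj₂ (there q) = inj₂ q
          aZ1' : ∀ W {u} → Z ≡ W ++ v ∷ Z2 → u ∈ W → a ∈ W
          aZ1' (z1 ∷ W') e p = subst (_∈ z1 ∷ W') (esym (LP.∷-injectiveˡ e)) (here refl)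
          aZ1 : ∀ {u} → u ∈ Z1 → a ∈ Z1
          aZ1 p = aZ1' Z1 eqZ p
          bZ2' : ∀ W {u} → Z ≡ Z1 ++ v ∷ W → u ∈ W → b ∈ W
          bZ2' (z2 ∷ W') e p with init-last z2 W'
          ... | I2 , e2 = subst (_∈ z2 ∷ W')
                  (esym (LP.∷ʳ-injectiveʳ (a ∷ R1) (Z1 ++ v ∷ I2)
                     (trans e (trans (cong (λ t → Z1 ++ v ∷ t) e2) (esym (LP.++-assoc Z1 (v ∷ I2) (lastOf z2 W' ∷ [])))))))
                  (lastOf-∈ z2 W')
          bZ2 : ∀ {u} → u ∈ Z2 → b ∈ Z2
          bZ2 p = bZ2' Z2 eqZ p
          crossNN : ∀ u u' → u ∈ Z1 → u' ∈ Z2 → ¬ ¬ Reach K u u'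
          crossNN u u' p p' k = g (λ bv → proj₁ (proj₂ bl) v (bv , a , b , (a∈B , a≢v) , (b∈B , b≢v) ,
                                     (λ r → kab (Reach-mono monoBv r))))
            where
              a≢v = ne1 (aZ1 p)
              b≢v = ne2 (bZ2 p')
              kab : ¬ Reach K a b
              kab r = k (Reach-trans (reach1 u a p (aZ1 p)) (Reach-trans r (reach2 b u' (bZ2 p') p')))
              monoBv : (B -ᵛ v) ⊆ᴳ K
              monoBv = (λ t bt → BinZ t (proj₁ bt) , proj₂ bt) , (λ t t' e → inj₁ (proj₁ e) , proj₂ e)
              g : ¬ ¬ inV B v
              g v∉B = kab (Reach-mono (mb , me) (proj₂ (proj₁ bl) a b a∈B b∈B))
                where
                  mb : ∀ t → inV B t → inV K t
                  mb t bt = BinZ t bt , (λ e → v∉B (subst (inV B) e bt))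
                  me : ∀ t t' → inE B t t' → inE K t t'
                  me t t' e = inj₁ e , (λ q → v∉B (subst (inV B) q (proj₁ (inE-V B e)))) ,
                                       (λ q → v∉B (subst (inV B) q (proj₂ (inE-V B e))))
          fin : y ∈ Z1 ⊎ y ∈ Z2 → y' ∈ Z1 ⊎ y' ∈ Z2 → ⊥
          fin (inj₁ p) (inj₁ p') = nr (reach1 y y' p p')
          fin (inj₂ p) (inj₂ p') = nr (reach2 y y' p p')
          fin (inj₁ p) (inj₂ p') = crossNN y y' p p' nr
          fin (inj₂ p) (inj₁ p') = crossNN y' y p' p (λ r → nr (Reach-sym r))

      HsubB : H ⊆ᴳ B
      HsubB = proj₂ (proj₂ bl) H B⊆H connH noArtH

      zeB : ∀ u w → Consecutive Z u w → inE B u w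
      zeB u w z = proj₂ HsubB u w (inj₂ (inj₁ z))

      neApp : ∀ (Y2 : List V) c → ∃ λ h → ∃ λ Tl → Y2 ++ c ∷ [] ≡ h ∷ Tl
      neApp [] c = c , [] , refl
      neApp (t ∷ Y) c = t , Y ++ c ∷ [] , refl

      interior : ∀ r₁ Y1 y' Y2 → R1 ≡ r₁ ∷ Y1 ++ y' ∷ Y2 → inE B a y' → ⊥
      interior r₁ Y1 y' Y2 refl eay' with neApp Y2 b
      ... | h2 , T2 , eh = at-most-two-neighbours {y'} (inE-sym B eay') (inE-sym B (zeB _ _ zn1)) (zeB _ _ zh2) a≢n1 a≢h2 n1≢h2
        where
          eqZ2 : Z ≡ a ∷ (r₁ ∷ Y1) ++ y' ∷ h2 ∷ T2
          eqZ2 = cong (λ t → a ∷ r₁ ∷ t) (trans (LP.++-assoc Y1 (y' ∷ Y2) (b ∷ [])) (cong (λ t → Y1 ++ y' ∷ t) eh))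
          n1 = lastOf r₁ Y1
          zn1 : Consecutive Z n1 y'
          zn1 = subst (λ t → Consecutive t n1 y') (esym eqZ2) (Consecutive-∷ a _ (Consecutive-last r₁ Y1 y' (h2 ∷ T2)))
          zh2 : Consecutive Z y' h2
          zh2 = subst (λ t → Consecutive t y' h2) (esym eqZ2) (Consecutive-∷ a _ (Consecutive-middle (r₁ ∷ Y1) y' h2 T2))
          uZ2 = subst Uniq eqZ2 uZ
          a∉ = proj₁ uZ2
          dj = proj₂ (proj₂ (Uniq-++⁻ (r₁ ∷ Y1) (y' ∷ h2 ∷ T2) (proj₂ uZ2)))
          a≢n1 : a ≢ n1
          a≢n1 e = a∉ (∈-++⁺ˡ (subst (_∈ r₁ ∷ Y1) (esym e) (lastOf-∈ r₁ Y1)))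
          a≢h2 : a ≢ h2
          a≢h2 e = a∉ (∈-++⁺ʳ (r₁ ∷ Y1) (there (here e)))
          n1≢h2 : n1 ≢ h2
          n1≢h2 e = dj n1 (lastOf-∈ r₁ Y1) (there (here e))

      from-first-step : ∀ R1' → R1 ≡ R1' → ⊥
      from-first-step [] refl = na (inE-adj B (zeB a b (inj₁ (refl , refl))))
      from-first-step (r₁ ∷ R1') refl with other-neighbour (zeB a r₁ (inj₁ (refl , refl)))
      ... | y' , eay' , y'≢r1 with BinZ y' (proj₂ (inE-V B eay'))
      ...   | here e = Adj⇒≢ (inE-adj B eay') (esym e)
      ...   | there q with ∈-++⁻ (r₁ ∷ R1') q
      ...     | inj₂ (here e) = na (subst (A a) e (inE-adj B eay'))
      ...     | inj₂ (there ())
      ...     | inj₁ (here e) = y'≢r1 e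
      ...     | inj₁ (there q') with ∈-∃++ q'
      ...       | Y1 , Y2 , refl = interior r₁ Y1 y' Y2 refl eay'

      impossible : ⊥
      impossible = from-first-step R1 refl

  Traceable⇒Cond3 : IsCactus G → ∀ P → Path P → (∀ v → v ∈ P) → Cond3 G
  Traceable⇒Cond3 cact P pP cP B bl a b a≢b a∈B b∈B art-a art-b with proj₂ cact B bl
  ... | inj₁ se = inE-adj B (SingleEdge.distinct⇒edge B se a∈B b∈B a≢b)
  ... | inj₂ cy with Adj? a b
  ...   | yes e = e
  ...   | no na with ∈-∃++ (cP a)
  ...     | L , R , eq with Necessity.sideOf P pP cP L a R eq b (λ e → a≢b (esym e))
  ...       | inj₂ bR with ∈-∃++ bR
  ...         | R1 , R2 , refl = ⊥-elim (Necessity.NonAdjacentArticulations.impossible P pP cP B bl cy a b a≢b a∈B b∈B art-a art-b na L R1 R2 eq)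
  Traceable⇒Cond3 cact P pP cP B bl a b a≢b a∈B b∈B art-a art-b | inj₂ cy | no na | L , R , eq | inj₁ bL
    with ∈-∃++ (AnyP.reverse⁺ {xs = L} bL)
  ... | R1 , R2 , e = ⊥-elim (Necessity.NonAdjacentArticulations.impossible (reverse P) (Path-reverse P pP) (λ v → AnyP.reverse⁺ {xs = P} (cP v))
                         B bl cy a b a≢b a∈B b∈B art-a art-b na (reverse R) R1 R2 eq'')
    where
      eq' : reverse P ≡ reverse R ++ a ∷ reverse L
      eq' = trans (cong reverse eq) (trans (LP.++-ʳ++ L {a ∷ R} {[]}) (esym (ʳ++-++ R [] (a ∷ reverse L))))
      eq'' : reverse P ≡ reverse R ++ a ∷ (R1 ++ b ∷ R2)
      eq'' = trans eq' (cong (λ t → reverse R ++ a ∷ t) e)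

theorem1 : (G : Graph) → IsCactus G →
    Traceable G ⇔ (Cond1 G × Cond2 G × Cond3 G)
theorem1 G cactus = mk⇔ necessary sufficient
  where
    necessary : Traceable G → Cond1 G × Cond2 G × Cond3 G
    necessary tr with Traceable⇒SpanningPath G tr
    ... | P , path , spans = Necessity.cond1 G P path spans , Necessity.cond2 G P path spans ,
                             Traceable⇒Cond3 G cactus P path spans
    sufficient : Cond1 G × Cond2 G × Cond3 G → Traceable G
    sufficient (c1 , c2 , c3) = Sufficiency.traceable G cactus c1 c2 c3
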